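{- Let $G$ be a strongly regular graph with parameters $(n,d,\lambda,\mu)$, and let $t=\sqrt{(\mu-\lambda)^2+4(d-\mu)}$. Then $\alpha(G)\le\Big\lfloor\frac{n(t+\mu-\lambda)}{2d+t+\mu-\lambda}\Big\rfloor$, $\alpha_f(G)\ge\frac{n(t+\mu-\lambda)}{2d+t+\mu-\lambda}$; $\omega(G)\le1+\Big\lfloor\frac{2d}{t+\mu-\lambda}\Big\rfloor$, $\omega_f(G)\ge1+\frac{2d}{t+\mu-\lambda}$; $\chi(G)\ge1+\Big\lceil\frac{2d}{t+\mu-\lambda}\Big\rceil$, $\chi_f(G)\ge1+\frac{2d}{t+\mu-\lambda}$; $\chi(\overline{G})\ge\Big\lceil\frac{n(t+\mu-\lambda)}{2d+t+\mu-\lambda}\Big\rceil$, $\chi_f(\overline{G})\ge\frac{n(t+\mu-\lambda)}{2d+t+\mu-\lambda}$.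
   Context: A strongly regular graph with parameters $(n,d,\lambda,\mu)$ is a $d$-regular graph on $n$ vertices, neither complete nor edgeless, in which every two adjacent vertices have exactly $\lambda$ common neighbors and every two distinct nonadjacent vertices exactly $\mu$ common neighbors. $\alpha,\omega,\chi$ are independence, clique, chromatic numbers; $\overline{G}$ is the complement. The fractional chromatic number $\chi_f(G)$ is the optimum of the LP minimizing $\sum_I x_I$ over nonnegative weights on independent sets $I$ subject to $\sum_{I\ni v}x_I\ge1$ for all vertices $v$; the fractional clique number $\omega_f(G)$ is the optimum of the LP maximizing $\sum_v x_v$ over nonnegative vertex weights with $\sum_{v\in I}x_v\le1$ for every (maximal) independent set $I$ (so $\omega_f(G)=\chi_f(G)$), and the fractional independence number is $\alpha_f(G)=\omega_f(\overline{G})=\chi_f(\overline{G})$. -}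

module Defs where

open import Data.Nat as ℕ using (ℕ; zero; suc)
open import Data.Integer as ℤ using (ℤ; +_)
open import Data.Rational as ℚ using (ℚ; 0ℚ; 1ℚ; _+_; _*_; _-_; -_; _≤_; _<_)
open import Data.Fin using (Fin; zero; suc)
open import Data.Fin.Properties using (_≟_)
open import Data.Bool using (Bool; true; false; _∧_; not; if_then_else_)
open import Data.List using (List; []; _∷_)
open import Data.List.Relation.Unary.All using (All)
open import Data.Product using (Σ; ∃; ∃-syntax; _×_; _,_; proj₁; proj₂)
open import Data.Sum using (_⊎_)
open import Relation.Nullary using (¬_; does)
open import Relation.Binary.PropositionalEquality using (_≡_; _≢_)

Adj : ℕ → Set
Adj n = Fin n → Fin n → Bool

record IsSimpleGraph {n : ℕ} (adj : Adj n) : Set where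
  field
    symmetric   : ∀ u v → adj u v ≡ adj v u
    irreflexive : ∀ v → adj v v ≡ false

count : ∀ {n} → (Fin n → Bool) → ℕ
count {zero}  P = 0
count {suc n} P = (if P zero then 1 else 0) ℕ.+ count {n} (λ i → P (suc i))

common : ∀ {n} → Adj n → Fin n → Fin n → ℕ
common adj u v = count (λ w → adj u w ∧ adj v w)

record IsSRG (n d lam mu : ℕ) (adj : Adj n) : Set where
  field
    simple      : IsSimpleGraph adj
    regular     : ∀ v → count (adj v) ≡ d
    adjCommon   : ∀ u v → adj u v ≡ true → common adj u v ≡ lam
    nonadjCommon : ∀ u v → u ≢ v → adj u v ≡ false → common adj u v ≡ mu
    notComplete : ∃[ u ] ∃[ v ] (u ≢ v × adj u v ≡ false)
    notEdgeless : ∃[ u ] ∃[ v ] (adj u v ≡ true)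

compl : ∀ {n} → Adj n → Adj n
compl adj u v = not (adj u v) ∧ not (does (u ≟ v))

VSet : ℕ → Set
VSet n = Fin n → Bool

IsIndependent : ∀ {n} → Adj n → VSet n → Set
IsIndependent adj S = ∀ u v → S u ≡ true → S v ≡ true → adj u v ≡ false

IsClique : ∀ {n} → Adj n → VSet n → Set
IsClique adj S = ∀ u v → u ≢ v → S u ≡ true → S v ≡ true → adj u v ≡ true

size : ∀ {n} → VSet n → ℕ
size S = count S

IsProperColouring : ∀ {n} → Adj n → (k : ℕ) → (Fin n → Fin k) → Set
IsProperColouring adj k c = ∀ u v → adj u v ≡ true → c u ≢ c v

ℕtoℚ : ℕ → ℚ
ℕtoℚ m = (+ m) ℚ./ 1

ℤtoℚ : ℤ → ℚ
ℤtoℚ z = z ℚ./ 1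

sumℚ : ∀ {n} → (Fin n → ℚ) → ℚ
sumℚ {zero}  x = 0ℚ
sumℚ {suc n} x = x zero + sumℚ {n} (λ i → x (suc i))

sumOver : ∀ {n} → VSet n → (Fin n → ℚ) → ℚ
sumOver S x = sumℚ (λ v → if S v then x v else 0ℚ)

-- Fractional colourings: a finitely supported nonnegative weighting of
-- independent sets, given as a list of (independent set, weight) pairs
-- (repeated sets simply add up their weights).

FracColouring : ℕ → Set
FracColouring n = List (VSet n × ℚ)

weightAt : ∀ {n} → FracColouring n → Fin n → ℚ
weightAt []            v = 0ℚ
weightAt ((I , w) ∷ f) v = (if I v then w else 0ℚ) + weightAt f v

totalWeight : ∀ {n} → FracColouring n → ℚ
totalWeight []            = 0ℚ
totalWeight ((I , w) ∷ f) = w + totalWeight f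

record IsFracColouring {n : ℕ} (adj : Adj n) (f : FracColouring n) : Set where
  field
    independent : All (λ p → IsIndependent adj (proj₁ p)) f
    nonneg      : All (λ p → 0ℚ ≤ proj₂ p) f
    covers      : ∀ v → 1ℚ ≤ weightAt f v

record IsFracClique {n : ℕ} (adj : Adj n) (x : Fin n → ℚ) : Set where
  field
    nonneg : ∀ v → 0ℚ ≤ x v
    bounded : ∀ I → IsIndependent adj I → sumOver I x ≤ 1ℚ

-- Real quadratic surds a + b·√D (D ≥ 0 rational), enough arithmetic to
-- write the bounds of the theorem, and their order.

record Surd : Set where
  constructor _+√_
  field
    re : ℚ
    im : ℚ
open Surd public

infixl 6 _⊕_ _⊖_
infixl 7 _⊛_

↑ : ℚ → Surd
↑ q = q +√ 0ℚ

√D : Surd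
√D = 0ℚ +√ 1ℚ

_⊕_ : Surd → Surd → Surd
(a +√ b) ⊕ (c +√ e) = (a + c) +√ (b + e)

_⊖_ : Surd → Surd → Surd
(a +√ b) ⊖ (c +√ e) = (a - c) +√ (b - e)

_⊛_ : ℚ → Surd → Surd
q ⊛ (a +√ b) = (q * a) +√ (q * b)

-- a + b·√D ≥ 0  (for D ≥ 0), decided by the signs and squares
NonNeg : ℚ → Surd → Set
NonNeg D (a +√ b) =
    (0ℚ ≤ a × 0ℚ ≤ b)
  ⊎ (0ℚ ≤ a × b < 0ℚ × b * b * D ≤ a * a)
  ⊎ (a < 0ℚ × 0ℚ ≤ b × a * a ≤ b * b * D)

_≤[_]_ : Surd → ℚ → Surd → Set
x ≤[ D ] y = NonNeg D (y ⊖ x)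

-- q ≤ N / M, for a positive surd M: q·M ≤ N
_≤[_]_∕_ : ℚ → ℚ → Surd → Surd → Set
q ≤[ D ] N ∕ M = (q ⊛ M) ≤[ D ] N

-- N / M ≤ q, for a positive surd M: N ≤ q·M
_∕_≤[_]_ : Surd → Surd → ℚ → ℚ → Set
N ∕ M ≤[ D ] q = N ≤[ D ] (q ⊛ M)

IsFloor : ℚ → ℕ → Surd → Surd → Set
IsFloor D m N M = (ℕtoℚ m ≤[ D ] N ∕ M) × ¬ (ℕtoℚ (suc m) ≤[ D ] N ∕ M)

IsCeil : ℚ → ℕ → Surd → Surd → Set
IsCeil D m N M = (N ∕ M ≤[ D ] ℕtoℚ m) × ¬ (N ∕ M ≤[ D ] (ℤtoℚ (+ m ℤ.- + 1)))

{-# OPTIONS --safe #-}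
-- With e = d − μ, c = μ − λ and t = √(c² + 4e), the form F(p, q) = e p² + d c p q − d² q² is
-- nonnegative, for p ≥ 0 and q > 0, exactly when p / q ≥ 2d / (t + c).
-- For an independent set S of size a let k_v be the number of neighbours of v in S. Then
-- Σ k_v = a d, and counting pairs of S through their μ common neighbours gives
-- Σ k_v² = a (a μ + d − μ). As k vanishes on S, Cauchy–Schwarz over the n − a other vertices
-- and the identity d (d − λ − 1) = (n − d − 1) μ give F(n − a, a) ≥ 0, i.e.
-- a ≤ n (t + c) / (2d + t + c). For a clique of size w the same count, with λ for μ and
-- k = w − 1 on the clique, gives F(w − 1, 1) ≤ 0, i.e. w − 1 ≤ 2d / (t + c).
-- The chromatic bounds follow because some colour class has at least n / k vertices, the
-- fractional ones because the constant weighting 1 / B, with B the largest admissible size, is a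
-- fractional clique, while a fractional colouring of total weight W satisfies n ≤ B W.
module Submission where

open import Level using (0ℓ)
open import Data.Bool using (Bool; true; false; _∧_; not; if_then_else_)
open import Data.Empty using (⊥-elim)
open import Data.Fin using (Fin; zero; suc)
open import Data.Fin.Properties using (_≟_)
import Data.Integer as ℤ
import Data.Integer.Properties as ℤₚ
open import Data.List using ([]; _∷_)
open import Data.List.Relation.Unary.All as All using (All; []; _∷_)
open import Data.Nat as ℕ using (ℕ; zero; suc; z≤n; s≤s)
import Data.Nat.Properties as ℕₚ
import Data.Nat.Tactic.RingSolver as ℕ-Solver
open import Data.Product using (_,_; _×_; ∃-syntax; proj₁; proj₂)
open import Data.Rational as ℚ using (ℚ; 0ℚ; 1ℚ; _+_; _*_; _-_; -_; _≤_; _<_)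
import Data.Rational.Properties as ℚₚ
import Data.Rational.Unnormalised as ℚᵘ
import Data.Rational.Unnormalised.Properties as ℚᵘₚ
open import Data.Sum using (inj₁; inj₂)
open import Function using (_∘_)
open import Relation.Binary.PropositionalEquality
open import Relation.Nullary using (yes; no; does; Dec)
open import Relation.Nullary.Decidable using (dec⇒maybe)
open import Tactic.RingSolver using (solve-∀)
open import Tactic.RingSolver.Core.AlmostCommutativeRing
  using (AlmostCommutativeRing; fromCommutativeRing)
open import Algebra.Properties.CommutativeSemigroup ℕₚ.*-commutativeSemigroup using (x∙yz≈y∙xz)
open import Algebra.Properties.Semiring.Sum ℕₚ.+-*-semiring
  using (sum; sum-cong-≗; ∑-distrib-+; ∑-comm; *-distribˡ-sum; *-distribʳ-sum)
open import Defs

-- Rational arithmetic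

ℚ-ring : AlmostCommutativeRing 0ℓ 0ℓ
ℚ-ring = fromCommutativeRing ℚₚ.+-*-commutativeRing (λ x → dec⇒maybe (0ℚ ℚₚ.≟ x))

toℚᵘ-ℕtoℚ : ∀ m → ℚ.toℚᵘ (ℕtoℚ m) ℚᵘ.≃ ℚᵘ.mkℚᵘ (ℤ.+ m) 0
toℚᵘ-ℕtoℚ m = ℚₚ.toℚᵘ-fromℚᵘ (ℚᵘ.mkℚᵘ (ℤ.+ m) 0)

ℕtoℚ-+ : ∀ a b → ℕtoℚ (a ℕ.+ b) ≡ ℕtoℚ a + ℕtoℚ b
ℕtoℚ-+ a b = ℚₚ.toℚᵘ-injective (begin
  ℚ.toℚᵘ (ℕtoℚ (a ℕ.+ b))                 ≈⟨ toℚᵘ-ℕtoℚ (a ℕ.+ b) ⟩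
  ℚᵘ.mkℚᵘ (ℤ.+ (a ℕ.+ b)) 0                  ≈⟨ ℚᵘ.*≡* (cong (ℤ._* ℤ.+ 1) numerators) ⟩
  ℚᵘ.mkℚᵘ (ℤ.+ a) 0 ℚᵘ.+ ℚᵘ.mkℚᵘ (ℤ.+ b) 0     ≈⟨ ℚᵘₚ.+-cong (toℚᵘ-ℕtoℚ a) (toℚᵘ-ℕtoℚ b) ⟨
  ℚ.toℚᵘ (ℕtoℚ a) ℚᵘ.+ ℚ.toℚᵘ (ℕtoℚ b)    ≈⟨ ℚₚ.toℚᵘ-homo-+ (ℕtoℚ a) (ℕtoℚ b) ⟨
  ℚ.toℚᵘ (ℕtoℚ a + ℕtoℚ b)                 ∎)
  where
  open ℚᵘₚ.≃-Reasoning
  numerators : ℤ.+ (a ℕ.+ b) ≡ ℤ.+ a ℤ.* ℤ.+ 1 ℤ.+ ℤ.+ b ℤ.* ℤ.+ 1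
  numerators = trans (ℤₚ.pos-+ a b) (sym (cong₂ ℤ._+_ (ℤₚ.*-identityʳ (ℤ.+ a)) (ℤₚ.*-identityʳ (ℤ.+ b))))

ℕtoℚ-* : ∀ a b → ℕtoℚ (a ℕ.* b) ≡ ℕtoℚ a * ℕtoℚ b
ℕtoℚ-* a b = ℚₚ.toℚᵘ-injective (begin
  ℚ.toℚᵘ (ℕtoℚ (a ℕ.* b))                 ≈⟨ toℚᵘ-ℕtoℚ (a ℕ.* b) ⟩
  ℚᵘ.mkℚᵘ (ℤ.+ (a ℕ.* b)) 0                  ≈⟨ ℚᵘ.*≡* (cong (ℤ._* ℤ.+ 1) (ℤₚ.pos-* a b)) ⟩
  ℚᵘ.mkℚᵘ (ℤ.+ a) 0 ℚᵘ.* ℚᵘ.mkℚᵘ (ℤ.+ b) 0     ≈⟨ ℚᵘₚ.*-cong (toℚᵘ-ℕtoℚ a) (toℚᵘ-ℕtoℚ b) ⟨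
  ℚ.toℚᵘ (ℕtoℚ a) ℚᵘ.* ℚ.toℚᵘ (ℕtoℚ b)    ≈⟨ ℚₚ.toℚᵘ-homo-* (ℕtoℚ a) (ℕtoℚ b) ⟨
  ℚ.toℚᵘ (ℕtoℚ a * ℕtoℚ b)                 ∎)
  where open ℚᵘₚ.≃-Reasoning

ℕtoℚ-mono-≤ : ∀ {a b} → a ℕ.≤ b → ℕtoℚ a ≤ ℕtoℚ b
ℕtoℚ-mono-≤ {a} {b} a≤b = ℚₚ.toℚᵘ-cancel-≤ (begin
  ℚ.toℚᵘ (ℕtoℚ a)  ≃⟨ toℚᵘ-ℕtoℚ a ⟩
  ℚᵘ.mkℚᵘ (ℤ.+ a) 0  ≤⟨ ℚᵘ.*≤* (ℤₚ.*-monoʳ-≤-nonNeg (ℤ.+ 1) (ℤ.+≤+ a≤b)) ⟩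
  ℚᵘ.mkℚᵘ (ℤ.+ b) 0  ≃⟨ toℚᵘ-ℕtoℚ b ⟨
  ℚ.toℚᵘ (ℕtoℚ b)  ∎)
  where open ℚᵘₚ.≤-Reasoning

ℕtoℚ-nonNeg : ∀ m → 0ℚ ≤ ℕtoℚ m
ℕtoℚ-nonNeg m = ℕtoℚ-mono-≤ {0} {m} z≤n

ℕtoℚ-pos : ∀ {m} → 1 ℕ.≤ m → 0ℚ < ℕtoℚ m
ℕtoℚ-pos {m} 1≤m = ℚₚ.<-≤-trans (ℚₚ.positive⁻¹ 1ℚ) (ℕtoℚ-mono-≤ {1} {m} 1≤m)

+-ℕtoℚ-* : ∀ m r → r + ℕtoℚ m * r ≡ ℕtoℚ (suc m) * r
+-ℕtoℚ-* m r = begin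
  r + ℕtoℚ m * r          ≡⟨ cong (_+ ℕtoℚ m * r) (ℚₚ.*-identityˡ r) ⟨
  1ℚ * r + ℕtoℚ m * r     ≡⟨ ℚₚ.*-distribʳ-+ r 1ℚ (ℕtoℚ m) ⟨
  (1ℚ + ℕtoℚ m) * r       ≡⟨ cong (_* r) (ℕtoℚ-+ 1 m) ⟨
  ℕtoℚ (suc m) * r        ∎
  where open ≡-Reasoning

ℕtoℚ-inverse : ∀ {B} → 1 ℕ.≤ B → ∃[ r ] (0ℚ ≤ r × ℕtoℚ B * r ≡ 1ℚ)
ℕtoℚ-inverse {B} 1≤B =
  r ,
  ℚₚ.nonNegative⁻¹ r {{ℚₚ.pos⇒nonNeg r {{ℚₚ.1/pos⇒pos (ℕtoℚ B)}}}} ,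
  ℚₚ.*-inverseʳ (ℕtoℚ B) {{ℚₚ.pos⇒nonZero (ℕtoℚ B)}}
  where
  instance _ = ℚ.positive (ℕtoℚ-pos 1≤B)
  r = (ℚ.1/ ℕtoℚ B) {{ℚₚ.pos⇒nonZero (ℕtoℚ B)}}

sub-add-cancel : ∀ p q → q - p + p ≡ q
sub-add-cancel = solve-∀ ℚ-ring

add-sub-cancel : ∀ p q → p + q - q ≡ p
add-sub-cancel = solve-∀ ℚ-ring

add-sub-cancelˡ : ∀ p q → p + q - p ≡ q
add-sub-cancelˡ = solve-∀ ℚ-ring

sub-*-zero : ∀ p q → p - q * 0ℚ ≡ p
sub-*-zero = solve-∀ ℚ-ring

*-left-comm : ∀ p q r → p * (q * r) ≡ q * (p * r)
*-left-comm = solve-∀ ℚ-ring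

p≤q⇒0≤q-p : ∀ {p q} → p ≤ q → 0ℚ ≤ q - p
p≤q⇒0≤q-p {p} {q} p≤q = subst (_≤ q - p) (ℚₚ.+-inverseʳ p) (ℚₚ.+-monoˡ-≤ (- p) p≤q)

0≤q-p⇒p≤q : ∀ {p q} → 0ℚ ≤ q - p → p ≤ q
0≤q-p⇒p≤q {p} {q} h = subst₂ _≤_ (ℚₚ.+-identityˡ p) (sub-add-cancel p q) (ℚₚ.+-monoˡ-≤ p h)

+-nonNeg : ∀ {p q} → 0ℚ ≤ p → 0ℚ ≤ q → 0ℚ ≤ p + q
+-nonNeg = ℚₚ.+-mono-≤

*-nonNeg : ∀ {p q} → 0ℚ ≤ p → 0ℚ ≤ q → 0ℚ ≤ p * q
*-nonNeg {p} {q} 0≤p 0≤q = ℚₚ.nonNegative⁻¹ (p * q)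
  {{ℚₚ.nonNeg*nonNeg⇒nonNeg p {{ℚ.nonNegative 0≤p}} q {{ℚ.nonNegative 0≤q}}}}

*-pos : ∀ {p q} → 0ℚ < p → 0ℚ < q → 0ℚ < p * q
*-pos {p} {q} 0<p 0<q = ℚₚ.positive⁻¹ (p * q)
  {{ℚₚ.pos*pos⇒pos p {{ℚ.positive 0<p}} q {{ℚ.positive 0<q}}}}

square-nonNeg : ∀ p → 0ℚ ≤ p * p
square-nonNeg p with ℚₚ.≤-total 0ℚ p
... | inj₁ 0≤p = *-nonNeg 0≤p 0≤p
... | inj₂ p≤0 = ℚₚ.nonNegative⁻¹ (p * p)
  {{ℚₚ.nonPos*nonPos⇒nonPos p {{ℚ.nonPositive p≤0}} p {{ℚ.nonPositive p≤0}}}}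

*-cancelˡ-nonNeg : ∀ {p q} → 0ℚ < p → 0ℚ ≤ p * q → 0ℚ ≤ q
*-cancelˡ-nonNeg {p} {q} 0<p h =
  ℚₚ.*-cancelˡ-≤-pos p {{ℚ.positive 0<p}} (subst (_≤ p * q) (sym (ℚₚ.*-zeroʳ p)) h)

*-cancelˡ-pos : ∀ {p q} → 0ℚ ≤ p → 0ℚ < p * q → 0ℚ < q
*-cancelˡ-pos {p} {q} 0≤p h =
  ℚₚ.*-cancelˡ-<-nonNeg p {{ℚ.nonNegative 0≤p}} (subst (_< p * q) (sym (ℚₚ.*-zeroʳ p)) h)

NonNeg-resp : ∀ {D x y x′ y′} → x ≡ x′ → y ≡ y′ → NonNeg D (x +√ y) → NonNeg D (x′ +√ y′)
NonNeg-resp refl refl h = h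

-- Comparing p / q with the positive root of a binary quadratic form

-- In these identities a p p + s c p q − s s q q is `form p q` of BinaryForm and c c + 4 a its D.

form-discriminant : ∀ a c s p q →
  p * p * (c * c + ℕtoℚ 4 * a) - (p * c - ℕtoℚ 2 * s * q) * (p * c - ℕtoℚ 2 * s * q)
    ≡ ℕtoℚ 4 * (a * p * p + s * c * p * q - s * s * q * q)
form-discriminant = solve-∀ ℚ-ring

form-discriminant⁻ : ∀ a c s p q →
  (- p) * (- p) * (c * c + ℕtoℚ 4 * a) - (ℕtoℚ 2 * s * q - p * c) * (ℕtoℚ 2 * s * q - p * c)
    ≡ ℕtoℚ 4 * (a * p * p + s * c * p * q - s * s * q * q)
form-discriminant⁻ = solve-∀ ℚ-ring

form-discriminant-neg : ∀ a c s p q →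
  (ℕtoℚ 2 * s * q - p * c) * (ℕtoℚ 2 * s * q - p * c) - (- p) * (- p) * (c * c + ℕtoℚ 4 * a)
    ≡ ℕtoℚ 4 * (0ℚ - (a * p * p + s * c * p * q - s * s * q * q))
form-discriminant-neg = solve-∀ ℚ-ring

form-split : ∀ a c s p q →
  a * p * p + s * c * p * q - s * s * q * q
    ≡ a * (p * p) + s * q * (- (ℕtoℚ 2 * s * q - p * c)) + s * s * (q * q)
form-split = solve-∀ ℚ-ring

form-split-neg : ∀ a c s p q →
  a * (p * p) + (0ℚ - (a * p * p + s * c * p * q - s * s * q * q)) + (s * q) * (s * q)
    ≡ (s * q) * (ℕtoℚ 2 * s * q - p * c)
form-split-neg = solve-∀ ℚ-ring

form-factor : ∀ a c s p q →
  (a * p * p + s * c * p * q - s * s * q * q) + (s * q) * (s * q) ≡ p * (a * p + s * c * q)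
form-factor = solve-∀ ℚ-ring

form-rescaleᴬ : ∀ a c s p q p′ q′ →
  q′ * q′ * (a * p * p + s * c * p * q - s * s * q * q)
    + (p′ * q - p * q′) * (a * (p′ * q - p * q′) + q′ * ((a * p + s * c * q) + a * p))
    ≡ (q * q) * (a * p′ * p′ + s * c * p′ * q′ - s * s * q′ * q′)
form-rescaleᴬ = solve-∀ ℚ-ring

form-rescaleᴮ : ∀ a c s p q p′ q′ →
  p′ * q′ * (0ℚ - (a * p * p + s * c * p * q - s * s * q * q))
    + s * s * (p * q′ - p′ * q) * q * q′ + a * p * p′ * (p * q′ - p′ * q)
    ≡ (p * q) * (0ℚ - (a * p′ * p′ + s * c * p′ * q′ - s * s * q′ * q′))
form-rescaleᴮ = solve-∀ ℚ-ring

module BinaryForm (a c s : ℚ) (0≤a : 0ℚ ≤ a) (0<s : 0ℚ < s) where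

  D : ℚ
  D = c * c + ℕtoℚ 4 * a

  form : ℚ → ℚ → ℚ
  form p q = a * p * p + s * c * p * q - s * s * q * q

  -- Since (√D − c)(√D + c) = 4a, the positive root of form r 1 is r = 2s / (√D + c);
  -- AboveRoot p q says p (√D + c) ≥ 2 s q, i.e. p / q ≥ r.
  AboveRoot : ℚ → ℚ → Set
  AboveRoot p q = NonNeg D ((p * c - ℕtoℚ 2 * s * q) +√ p)

  BelowRoot : ℚ → ℚ → Set
  BelowRoot p q = NonNeg D ((ℕtoℚ 2 * s * q - p * c) +√ (- p))

  private
    0≤s : 0ℚ ≤ s
    0≤s = ℚₚ.<⇒≤ 0<s

    4*-nonNeg : ∀ {p} → 0ℚ ≤ p → 0ℚ ≤ ℕtoℚ 4 * p
    4*-nonNeg = *-nonNeg (ℕtoℚ-nonNeg 4)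

  form-nonNeg⇒AboveRoot : ∀ {p q} → 0ℚ ≤ p → 0ℚ ≤ form p q → AboveRoot p q
  form-nonNeg⇒AboveRoot {p} {q} 0≤p 0≤form with 0ℚ ℚₚ.≤? p * c - ℕtoℚ 2 * s * q
  ... | yes 0≤x = inj₁ (0≤x , 0≤p)
  ... | no  0≰x = inj₂ (inj₂ (ℚₚ.≰⇒> 0≰x , 0≤p ,
    0≤q-p⇒p≤q (subst (0ℚ ≤_) (sym (form-discriminant a c s p q)) (4*-nonNeg 0≤form))))

  BelowRoot-nonPos : ∀ {p q} → 0ℚ ≤ q → p ≤ 0ℚ → BelowRoot p q
  BelowRoot-nonPos {p} {q} 0≤q p≤0 with 0ℚ ℚₚ.≤? ℕtoℚ 2 * s * q - p * c
  ... | yes 0≤x = inj₁ (0≤x , ℚₚ.neg-antimono-≤ p≤0)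
  ... | no  0≰x = inj₂ (inj₂ (x<0 , ℚₚ.neg-antimono-≤ p≤0 ,
    0≤q-p⇒p≤q (subst (0ℚ ≤_) (sym (form-discriminant⁻ a c s p q)) (4*-nonNeg 0≤form))))
    where
    x<0 = ℚₚ.≰⇒> 0≰x
    0≤form : 0ℚ ≤ form p q
    0≤form = subst (0ℚ ≤_) (sym (form-split a c s p q))
      (+-nonNeg (+-nonNeg (*-nonNeg 0≤a (square-nonNeg p))
                          (*-nonNeg (*-nonNeg 0≤s 0≤q) (ℚₚ.neg-antimono-≤ (ℚₚ.<⇒≤ x<0))))
                (*-nonNeg (square-nonNeg s) (square-nonNeg q)))

  BelowRoot-pos : ∀ {p q} → 0ℚ < q → 0ℚ < p → form p q ≤ 0ℚ → BelowRoot p q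
  BelowRoot-pos {p} {q} 0<q 0<p form≤0 = inj₂ (inj₁ (0≤x , ℚₚ.neg-antimono-< 0<p ,
    0≤q-p⇒p≤q (subst (0ℚ ≤_) (sym (form-discriminant-neg a c s p q)) (4*-nonNeg 0≤-form))))
    where
    0≤-form : 0ℚ ≤ 0ℚ - form p q
    0≤-form = p≤q⇒0≤q-p form≤0
    0≤x : 0ℚ ≤ ℕtoℚ 2 * s * q - p * c
    0≤x = *-cancelˡ-nonNeg (*-pos 0<s 0<q) (subst (0ℚ ≤_) (form-split-neg a c s p q)
      (+-nonNeg (+-nonNeg (*-nonNeg 0≤a (square-nonNeg p)) 0≤-form) (square-nonNeg (s * q))))

  form-nonNeg-mono : ∀ {p q p′ q′} → 0ℚ < q → 0ℚ < q′ → 0ℚ ≤ p → p * q′ ≤ p′ * q →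
                     0ℚ ≤ form p q → 0ℚ ≤ form p′ q′
  form-nonNeg-mono {p} {q} {p′} {q′} 0<q 0<q′ 0≤p pq′≤p′q 0≤form =
    *-cancelˡ-nonNeg (*-pos 0<q 0<q) (subst (0ℚ ≤_) (form-rescaleᴬ a c s p q p′ q′)
      (+-nonNeg (*-nonNeg (square-nonNeg q′) 0≤form)
                (*-nonNeg 0≤δ (+-nonNeg (*-nonNeg 0≤a 0≤δ)
                  (*-nonNeg (ℚₚ.<⇒≤ 0<q′) (+-nonNeg (ℚₚ.<⇒≤ 0<A) (*-nonNeg 0≤a 0≤p)))))))
    where
    0≤δ : 0ℚ ≤ p′ * q - p * q′
    0≤δ = p≤q⇒0≤q-p pq′≤p′q
    0<A : 0ℚ < a * p + s * c * q
    0<A = *-cancelˡ-pos 0≤p (subst (0ℚ <_) (form-factor a c s p q)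
      (ℚₚ.+-mono-≤-< 0≤form (*-pos (*-pos 0<s 0<q) (*-pos 0<s 0<q))))

  form-nonPos-mono : ∀ {p q p′ q′} → 0ℚ < q → 0ℚ < q′ → 0ℚ < p → 0ℚ ≤ p′ → p′ * q ≤ p * q′ →
                     form p q ≤ 0ℚ → form p′ q′ ≤ 0ℚ
  form-nonPos-mono {p} {q} {p′} {q′} 0<q 0<q′ 0<p 0≤p′ p′q≤pq′ form≤0 =
    0≤q-p⇒p≤q (*-cancelˡ-nonNeg (*-pos 0<p 0<q) (subst (0ℚ ≤_) (form-rescaleᴮ a c s p q p′ q′)
      (+-nonNeg (+-nonNeg (*-nonNeg (*-nonNeg 0≤p′ (ℚₚ.<⇒≤ 0<q′)) (p≤q⇒0≤q-p form≤0))
                          (*-nonNeg (*-nonNeg (*-nonNeg (square-nonNeg s) 0≤δ) (ℚₚ.<⇒≤ 0<q)) (ℚₚ.<⇒≤ 0<q′)))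
                (*-nonNeg (*-nonNeg (*-nonNeg 0≤a (ℚₚ.<⇒≤ 0<p)) 0≤p′) 0≤δ))))
    where
    0≤δ : 0ℚ ≤ p * q′ - p′ * q
    0≤δ = p≤q⇒0≤q-p p′q≤pq′

  AboveRoot-of : ∀ {p q p₀ q₀} → 0ℚ < q → 0ℚ < q₀ → 0ℚ ≤ p₀ → 0ℚ ≤ form p₀ q₀ →
                 p₀ * q ≤ p * q₀ → AboveRoot p q
  AboveRoot-of {p} {q} {p₀} {q₀} 0<q 0<q₀ 0≤p₀ 0≤form p₀q≤pq₀ =
    form-nonNeg⇒AboveRoot 0≤p (form-nonNeg-mono 0<q₀ 0<q 0≤p₀ p₀q≤pq₀ 0≤form)
    where
    0≤p : 0ℚ ≤ p
    0≤p = *-cancelˡ-nonNeg 0<q₀ (subst (0ℚ ≤_) (ℚₚ.*-comm p q₀)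
      (ℚₚ.≤-trans (*-nonNeg 0≤p₀ (ℚₚ.<⇒≤ 0<q)) p₀q≤pq₀))

  BelowRoot-of : ∀ {p q p₀ q₀} → 0ℚ < q → 0ℚ < q₀ → form p₀ q₀ ≤ 0ℚ →
                 p * q₀ ≤ p₀ * q → BelowRoot p q
  BelowRoot-of {p} {q} {p₀} {q₀} 0<q 0<q₀ form≤0 pq₀≤p₀q with 0ℚ ℚₚ.<? p
  ... | no  0≮p = BelowRoot-nonPos (ℚₚ.<⇒≤ 0<q) (ℚₚ.≮⇒≥ 0≮p)
  ... | yes 0<p = BelowRoot-pos 0<q 0<p (form-nonPos-mono 0<q₀ 0<q 0<p₀ (ℚₚ.<⇒≤ 0<p) pq₀≤p₀q form≤0)
    where
    0<p₀ : 0ℚ < p₀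
    0<p₀ = *-cancelˡ-pos (ℚₚ.<⇒≤ 0<q) (subst (0ℚ <_) (ℚₚ.*-comm p₀ q)
      (ℚₚ.<-≤-trans (*-pos 0<p 0<q₀) pq₀≤p₀q))

-- Finite sums of natural numbers

⟦_⟧ : Bool → ℕ
⟦ b ⟧ = if b then 1 else 0

⟦∧⟧ : ∀ a b → ⟦ a ∧ b ⟧ ≡ ⟦ a ⟧ ℕ.* ⟦ b ⟧
⟦∧⟧ true  b = sym (ℕₚ.+-identityʳ ⟦ b ⟧)
⟦∧⟧ false b = refl

⟦⟧*⟦⟧≤⟦⟧ : ∀ a b → ⟦ a ⟧ ℕ.* ⟦ b ⟧ ℕ.≤ ⟦ a ⟧
⟦⟧*⟦⟧≤⟦⟧ true  true  = s≤s z≤n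
⟦⟧*⟦⟧≤⟦⟧ true  false = z≤n
⟦⟧*⟦⟧≤⟦⟧ false b     = z≤n

⟦⟧≤1 : ∀ b → ⟦ b ⟧ ℕ.≤ 1
⟦⟧≤1 true  = s≤s z≤n
⟦⟧≤1 false = z≤n

count≡sum : ∀ {n} (P : Fin n → Bool) → count P ≡ sum (λ v → ⟦ P v ⟧)
count≡sum {zero}  P = refl
count≡sum {suc n} P = cong (⟦ P zero ⟧ ℕ.+_) (count≡sum (P ∘ suc))

sum-const : ∀ {n} k → sum {n} (λ _ → k) ≡ n ℕ.* k
sum-const {zero}  k = refl
sum-const {suc n} k = cong (k ℕ.+_) (sum-const {n} k)

sum-mono-≤ : ∀ {n} {f g : Fin n → ℕ} → (∀ i → f i ℕ.≤ g i) → sum f ℕ.≤ sum g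
sum-mono-≤ {zero}  f≤g = z≤n
sum-mono-≤ {suc n} f≤g = ℕₚ.+-mono-≤ (f≤g zero) (sum-mono-≤ (f≤g ∘ suc))

∑-distrib-+₃ : ∀ {n} (f g h : Fin n → ℕ) →
  sum (λ v → f v ℕ.+ g v ℕ.+ h v) ≡ sum f ℕ.+ sum g ℕ.+ sum h
∑-distrib-+₃ f g h = trans (∑-distrib-+ (λ v → f v ℕ.+ g v) h) (cong (ℕ._+ sum h) (∑-distrib-+ f g))

δ : ∀ {n} → Fin n → Fin n → ℕ
δ u v = ⟦ does (u ≟ v) ⟧

sum-δ : ∀ {n} (u : Fin n) (f : Fin n → ℕ) → sum (λ v → δ u v ℕ.* f v) ≡ f u
sum-δ {suc n} zero    f = trans (cong (ℕ._+_ (f zero ℕ.+ 0)) (trans (sum-const {n} 0) (ℕₚ.*-zeroʳ n)))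
                          (trans (ℕₚ.+-identityʳ _) (ℕₚ.+-identityʳ (f zero)))
sum-δ {suc n} (suc u) f = sum-δ u (f ∘ suc)

term≤sum : ∀ {n} (f : Fin n → ℕ) u → f u ℕ.≤ sum f
term≤sum f u = subst (ℕ._≤ sum f) (sum-δ u f) (sum-mono-≤ weighted≤)
  where
  weighted≤ : ∀ v → δ u v ℕ.* f v ℕ.≤ f v
  weighted≤ v = ℕₚ.≤-trans (ℕₚ.*-monoˡ-≤ (f v) (⟦⟧≤1 (does (u ≟ v)))) (ℕₚ.≤-reflexive (ℕₚ.*-identityˡ (f v)))

2xy≤x²+y²-ordered : ∀ {x y} → x ℕ.≤ y → 2 ℕ.* (x ℕ.* y) ℕ.≤ x ℕ.* x ℕ.+ y ℕ.* y
2xy≤x²+y²-ordered {x} x≤y with ℕₚ.m≤n⇒∃[o]m+o≡n x≤y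
... | k , refl = ℕₚ.≤-trans (ℕₚ.m≤m+n _ (k ℕ.* k)) (ℕₚ.≤-reflexive (gap x k))
  where
  gap : ∀ x k → 2 ℕ.* (x ℕ.* (x ℕ.+ k)) ℕ.+ k ℕ.* k ≡ x ℕ.* x ℕ.+ (x ℕ.+ k) ℕ.* (x ℕ.+ k)
  gap = ℕ-Solver.solve-∀

2xy≤x²+y² : ∀ x y → 2 ℕ.* (x ℕ.* y) ℕ.≤ x ℕ.* x ℕ.+ y ℕ.* y
2xy≤x²+y² x y with ℕₚ.≤-total x y
... | inj₁ x≤y = 2xy≤x²+y²-ordered x≤y
... | inj₂ y≤x = subst₂ ℕ._≤_ (cong (2 ℕ.*_) (ℕₚ.*-comm y x)) (ℕₚ.+-comm (y ℕ.* y) (x ℕ.* x))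
                   (2xy≤x²+y²-ordered y≤x)

private
  cs-expand : ∀ a b c → (a ℕ.* b ℕ.+ c) ℕ.* (a ℕ.* b ℕ.+ c)
                      ≡ a ℕ.* a ℕ.* (b ℕ.* b) ℕ.+ a ℕ.* (2 ℕ.* b ℕ.* c) ℕ.+ c ℕ.* c
  cs-expand = ℕ-Solver.solve-∀

  cs-regroup : ∀ a b q t → a ℕ.* a ℕ.* (b ℕ.* b) ℕ.+ a ℕ.* (q ℕ.+ b ℕ.* b ℕ.* t) ℕ.+ t ℕ.* q
                         ≡ (a ℕ.+ t) ℕ.* (a ℕ.* (b ℕ.* b) ℕ.+ q)
  cs-regroup = ℕ-Solver.solve-∀

  cs-weights : ∀ t x y → 2 ℕ.* (y ℕ.* (t ℕ.* x)) ≡ t ℕ.* (2 ℕ.* (x ℕ.* y))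
  cs-weights = ℕ-Solver.solve-∀

  cs-spread : ∀ t x y → t ℕ.* (x ℕ.* x ℕ.+ y ℕ.* y) ≡ t ℕ.* (x ℕ.* x) ℕ.+ y ℕ.* y ℕ.* t
  cs-spread = ℕ-Solver.solve-∀

weighted-2xy≤x²+y² : ∀ t x y → 2 ℕ.* (y ℕ.* (t ℕ.* x)) ℕ.≤ t ℕ.* (x ℕ.* x) ℕ.+ y ℕ.* y ℕ.* t
weighted-2xy≤x²+y² t x y = subst₂ ℕ._≤_ (sym (cs-weights t x y)) (cs-spread t x y)
  (ℕₚ.*-monoʳ-≤ t (2xy≤x²+y² x y))

cauchy-schwarz : ∀ {n} (t f : Fin n → ℕ) →
  sum (λ v → t v ℕ.* f v) ℕ.* sum (λ v → t v ℕ.* f v)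
    ℕ.≤ sum t ℕ.* sum (λ v → t v ℕ.* (f v ℕ.* f v))
cauchy-schwarz {zero}  t f = z≤n
cauchy-schwarz {suc n} t f = begin
  (t₀ ℕ.* f₀ ℕ.+ F) ℕ.* (t₀ ℕ.* f₀ ℕ.+ F)
    ≡⟨ cs-expand t₀ f₀ F ⟩
  t₀ ℕ.* t₀ ℕ.* (f₀ ℕ.* f₀) ℕ.+ t₀ ℕ.* (2 ℕ.* f₀ ℕ.* F) ℕ.+ F ℕ.* F
    ≤⟨ ℕₚ.+-mono-≤ (ℕₚ.+-monoʳ-≤ (t₀ ℕ.* t₀ ℕ.* (f₀ ℕ.* f₀)) (ℕₚ.*-monoʳ-≤ t₀ cross)) (cauchy-schwarz (t ∘ suc) (f ∘ suc)) ⟩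
  t₀ ℕ.* t₀ ℕ.* (f₀ ℕ.* f₀) ℕ.+ t₀ ℕ.* (Q ℕ.+ f₀ ℕ.* f₀ ℕ.* T) ℕ.+ T ℕ.* Q
    ≡⟨ cs-regroup t₀ f₀ Q T ⟩
  (t₀ ℕ.+ T) ℕ.* (t₀ ℕ.* (f₀ ℕ.* f₀) ℕ.+ Q) ∎
  where
  open ℕₚ.≤-Reasoning
  t₀ = t zero
  f₀ = f zero
  T = sum (t ∘ suc)
  F = sum (λ v → t (suc v) ℕ.* f (suc v))
  Q = sum (λ v → t (suc v) ℕ.* (f (suc v) ℕ.* f (suc v)))
  cross : 2 ℕ.* f₀ ℕ.* F ℕ.≤ Q ℕ.+ f₀ ℕ.* f₀ ℕ.* T
  cross = begin
    2 ℕ.* f₀ ℕ.* F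
      ≡⟨ *-distribˡ-sum (2 ℕ.* f₀) (λ v → t (suc v) ℕ.* f (suc v)) ⟩
    sum (λ v → 2 ℕ.* f₀ ℕ.* (t (suc v) ℕ.* f (suc v)))
      ≡⟨ sum-cong-≗ (λ v → ℕₚ.*-assoc 2 f₀ (t (suc v) ℕ.* f (suc v))) ⟩
    sum (λ v → 2 ℕ.* (f₀ ℕ.* (t (suc v) ℕ.* f (suc v))))
      ≤⟨ sum-mono-≤ (λ v → weighted-2xy≤x²+y² (t (suc v)) (f (suc v)) f₀) ⟩
    sum (λ v → t (suc v) ℕ.* (f (suc v) ℕ.* f (suc v)) ℕ.+ f₀ ℕ.* f₀ ℕ.* t (suc v))
      ≡⟨ ∑-distrib-+ (λ v → t (suc v) ℕ.* (f (suc v) ℕ.* f (suc v))) (λ v → f₀ ℕ.* f₀ ℕ.* t (suc v)) ⟩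
    Q ℕ.+ sum (λ v → f₀ ℕ.* f₀ ℕ.* t (suc v))
      ≡⟨ cong (Q ℕ.+_) (*-distribˡ-sum (f₀ ℕ.* f₀) (t ∘ suc)) ⟨
    Q ℕ.+ f₀ ℕ.* f₀ ℕ.* T ∎

size-complement : ∀ {n} (S : VSet n) → size (not ∘ S) ℕ.+ size S ≡ n
size-complement {n} S = begin
  size (not ∘ S) ℕ.+ size S                          ≡⟨ cong₂ ℕ._+_ (count≡sum (not ∘ S)) (count≡sum S) ⟩
  sum (λ v → ⟦ not (S v) ⟧) ℕ.+ sum (λ v → ⟦ S v ⟧)  ≡⟨ ∑-distrib-+ (λ v → ⟦ not (S v) ⟧) (λ v → ⟦ S v ⟧) ⟨
  sum (λ v → ⟦ not (S v) ⟧ ℕ.+ ⟦ S v ⟧)              ≡⟨ sum-cong-≗ (λ v → one (S v)) ⟩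
  sum {n} (λ _ → 1)                                  ≡⟨ sum-const {n} 1 ⟩
  n ℕ.* 1                                            ≡⟨ ℕₚ.*-identityʳ n ⟩
  n                                                  ∎
  where
  open ≡-Reasoning
  one : ∀ b → ⟦ not b ⟧ ℕ.+ ⟦ b ⟧ ≡ 1
  one true  = refl
  one false = refl

sum-outside : ∀ {n} (S : VSet n) (f : Fin n → ℕ) x → (∀ v → S v ≡ true → f v ≡ x) →
              sum (λ v → ⟦ not (S v) ⟧ ℕ.* f v) ℕ.+ size S ℕ.* x ≡ sum f
sum-outside S f x f≡x = begin
  sum (λ v → ⟦ not (S v) ⟧ ℕ.* f v) ℕ.+ size S ℕ.* x
    ≡⟨ cong (λ y → sum (λ v → ⟦ not (S v) ⟧ ℕ.* f v) ℕ.+ y ℕ.* x) (count≡sum S) ⟩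
  sum (λ v → ⟦ not (S v) ⟧ ℕ.* f v) ℕ.+ sum (λ v → ⟦ S v ⟧) ℕ.* x
    ≡⟨ cong (sum (λ v → ⟦ not (S v) ⟧ ℕ.* f v) ℕ.+_) (*-distribʳ-sum x (λ v → ⟦ S v ⟧)) ⟩
  sum (λ v → ⟦ not (S v) ⟧ ℕ.* f v) ℕ.+ sum (λ v → ⟦ S v ⟧ ℕ.* x)
    ≡⟨ ∑-distrib-+ (λ v → ⟦ not (S v) ⟧ ℕ.* f v) (λ v → ⟦ S v ⟧ ℕ.* x) ⟨
  sum (λ v → ⟦ not (S v) ⟧ ℕ.* f v ℕ.+ ⟦ S v ⟧ ℕ.* x)
    ≡⟨ sum-cong-≗ split ⟩
  sum f ∎
  where
  open ≡-Reasoning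
  split : ∀ v → ⟦ not (S v) ⟧ ℕ.* f v ℕ.+ ⟦ S v ⟧ ℕ.* x ≡ f v
  split v with S v in Sv
  ... | true  = trans (ℕₚ.+-identityʳ x) (sym (f≡x v Sv))
  ... | false = trans (ℕₚ.+-identityʳ _) (ℕₚ.+-identityʳ (f v))

sum-outside-vanishing : ∀ {n} (S : VSet n) (f : Fin n → ℕ) → (∀ v → S v ≡ true → f v ≡ 0) →
                        sum (λ v → ⟦ not (S v) ⟧ ℕ.* f v) ≡ sum f
sum-outside-vanishing S f f≡0 = begin
  sum (λ v → ⟦ not (S v) ⟧ ℕ.* f v)                    ≡⟨ ℕₚ.+-identityʳ _ ⟨
  sum (λ v → ⟦ not (S v) ⟧ ℕ.* f v) ℕ.+ 0              ≡⟨ cong (sum (λ v → ⟦ not (S v) ⟧ ℕ.* f v) ℕ.+_) (ℕₚ.*-zeroʳ (size S)) ⟨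
  sum (λ v → ⟦ not (S v) ⟧ ℕ.* f v) ℕ.+ size S ℕ.* 0   ≡⟨ sum-outside S f 0 f≡0 ⟩
  sum f                                                ∎
  where open ≡-Reasoning

-- Vertex sets and colourings

≟-sound : ∀ {n} {u v : Fin n} → does (u ≟ v) ≡ true → u ≡ v
≟-sound {u = u} {v} eq with u ≟ v
... | yes u≡v = u≡v

fin⇒1≤ : ∀ {n} → Fin n → 1 ℕ.≤ n
fin⇒1≤ {suc n} _ = s≤s z≤n

singleton : ∀ {n} → Fin n → VSet n
singleton u v = does (u ≟ v)

size-singleton : ∀ {n} (u : Fin n) → size (singleton u) ≡ 1
size-singleton u = trans (count≡sum (singleton u))
  (trans (sum-cong-≗ (λ v → sym (ℕₚ.*-identityʳ (δ u v)))) (sum-δ u (λ _ → 1)))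

compl-independent⇒clique : ∀ {n} {adj : Adj n} {I} → IsIndependent (compl adj) I → IsClique adj I
compl-independent⇒clique {adj = adj} independent u v u≢v u∈ v∈ with adj u v | u ≟ v | independent u v u∈ v∈
... | true  | _         | _ = refl
... | false | yes u≡v   | _ = ⊥-elim (u≢v u≡v)
... | false | no  _     | ()

colourClass : ∀ {n k} → (Fin n → Fin k) → Fin k → VSet n
colourClass col j v = does (col v ≟ j)

colourClass-independent : ∀ {n k} {adj : Adj n} {col : Fin n → Fin k} →
  IsProperColouring adj k col → ∀ j → IsIndependent adj (colourClass col j)
colourClass-independent {adj = adj} {col} proper j u v u∈j v∈j with adj u v in uv
... | false = refl
... | true  = ⊥-elim (proper u v uv (trans (≟-sound u∈j) (sym (≟-sound v∈j))))

nonempty-class : ∀ {n k a} → 1 ℕ.≤ n → n ℕ.≤ k ℕ.* a → 1 ℕ.≤ a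
nonempty-class {k = k} {zero}  1≤n n≤ka = ℕₚ.≤-trans 1≤n (ℕₚ.≤-trans n≤ka (ℕₚ.≤-reflexive (ℕₚ.*-zeroʳ k)))
nonempty-class {a = suc a} _ _ = s≤s z≤n

argmax : ∀ {k} (f : Fin (suc k) → ℕ) → ∃[ j ] (∀ i → f i ℕ.≤ f j)
argmax {zero}  f = zero , λ { zero → ℕₚ.≤-refl }
argmax {suc k} f with argmax (f ∘ suc)
... | j , max with ℕₚ.≤-total (f zero) (f (suc j))
...   | inj₁ f₀≤ = suc j , λ { zero → f₀≤ ; (suc i) → max i }
...   | inj₂ ≤f₀ = zero  , λ { zero → ℕₚ.≤-refl ; (suc i) → ℕₚ.≤-trans (max i) ≤f₀ }

large-colourClass : ∀ {n k} (col : Fin n → Fin k) → Fin n → ∃[ j ] (n ℕ.≤ k ℕ.* size (colourClass col j))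
large-colourClass {n} {zero}  col v with col v
... | ()
large-colourClass {n} {suc k} col v with argmax (λ j → size (colourClass col j))
... | j , max = j , (begin
  n                                                    ≡⟨ classes-partition ⟨
  sum (λ i → size (colourClass col i))                 ≤⟨ sum-mono-≤ max ⟩
  sum {suc k} (λ _ → size (colourClass col j))         ≡⟨ sum-const {suc k} _ ⟩
  suc k ℕ.* size (colourClass col j)                   ∎)
  where
  open ℕₚ.≤-Reasoning
  classes-partition : sum (λ i → size (colourClass col i)) ≡ n
  classes-partition = begin-equality
    sum (λ i → size (colourClass col i))               ≡⟨ sum-cong-≗ (λ i → count≡sum (colourClass col i)) ⟩
    sum (λ i → sum (λ u → ⟦ does (col u ≟ i) ⟧))       ≡⟨ ∑-comm (λ i u → ⟦ does (col u ≟ i) ⟧) ⟩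
    sum (λ u → sum (λ i → ⟦ does (col u ≟ i) ⟧))       ≡⟨ sum-cong-≗ (λ u → trans (sum-cong-≗ (λ i → sym (ℕₚ.*-identityʳ (δ (col u) i)))) (sum-δ (col u) (λ _ → 1))) ⟩
    sum {n} (λ _ → 1)                                  ≡⟨ sum-const {n} 1 ⟩
    n ℕ.* 1                                            ≡⟨ ℕₚ.*-identityʳ n ⟩
    n                                                  ∎

≤-if-positive : ∀ {a m} → (1 ℕ.≤ a → a ℕ.≤ m) → a ℕ.≤ m
≤-if-positive {zero}  _ = z≤n
≤-if-positive {suc a} h = h (s≤s z≤n)

greatest : ∀ {P : ℕ → Set} → (∀ a → Dec (P a)) → ∀ N {a₀} → a₀ ℕ.≤ N → P a₀ →
           ∃[ m ] (P m × m ℕ.≤ N × ∀ a → a ℕ.≤ N → P a → a ℕ.≤ m)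
greatest P? zero    z≤n Pa₀ = 0 , Pa₀ , z≤n , λ { _ z≤n _ → z≤n }
greatest {P} P? (suc N) a₀≤ Pa₀ with P? (suc N)
... | yes PN = suc N , PN , ℕₚ.≤-refl , λ _ a≤ _ → a≤
... | no ¬PN =
  let m , Pm , m≤N , maximal = greatest P? N (below a₀≤ Pa₀) Pa₀
  in  m , Pm , ℕₚ.m≤n⇒m≤1+n m≤N , λ a a≤ Pa → maximal a (below a≤ Pa) Pa
  where
  below : ∀ {a} → a ℕ.≤ suc N → P a → a ℕ.≤ N
  below a≤ Pa = ℕₚ.≤-pred (ℕₚ.≤∧≢⇒< a≤ λ { refl → ¬PN Pa })

-- Fractional cliques and colourings

sumℚ-const : ∀ {n} r → sumℚ {n} (λ _ → r) ≡ ℕtoℚ n * r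
sumℚ-const {zero}  r = sym (ℚₚ.*-zeroˡ r)
sumℚ-const {suc n} r = trans (cong (r +_) (sumℚ-const {n} r)) (+-ℕtoℚ-* n r)

sumℚ-+ : ∀ {n} (x y : Fin n → ℚ) → sumℚ (λ v → x v + y v) ≡ sumℚ x + sumℚ y
sumℚ-+ {zero}  x y = refl
sumℚ-+ {suc n} x y = trans (cong (x zero + y zero +_) (sumℚ-+ (x ∘ suc) (y ∘ suc)))
                           (+-interchange (x zero) (y zero) (sumℚ (x ∘ suc)) (sumℚ (y ∘ suc)))
  where
  +-interchange : ∀ a b c d → a + b + (c + d) ≡ a + c + (b + d)
  +-interchange = solve-∀ ℚ-ring

sumℚ-mono-≤ : ∀ {n} {x y : Fin n → ℚ} → (∀ v → x v ≤ y v) → sumℚ x ≤ sumℚ y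
sumℚ-mono-≤ {zero}  x≤y = ℚₚ.≤-refl
sumℚ-mono-≤ {suc n} x≤y = ℚₚ.+-mono-≤ (x≤y zero) (sumℚ-mono-≤ (x≤y ∘ suc))

sumOver-const : ∀ {n} (I : VSet n) r → sumOver I (λ _ → r) ≡ ℕtoℚ (size I) * r
sumOver-const {zero}  I r = sym (ℚₚ.*-zeroˡ r)
sumOver-const {suc n} I r with I zero
... | true  = trans (cong (r +_) (sumOver-const (I ∘ suc) r)) (+-ℕtoℚ-* (size (I ∘ suc)) r)
... | false = trans (ℚₚ.+-identityˡ _) (sumOver-const (I ∘ suc) r)

sumℚ-weightAt-≤ : ∀ {n} (f : FracColouring n) {B} →
  All (λ p → size (proj₁ p) ℕ.≤ B) f → All (λ p → 0ℚ ≤ proj₂ p) f →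
  sumℚ (weightAt f) ≤ ℕtoℚ B * totalWeight f
sumℚ-weightAt-≤ {n} [] {B} [] [] = begin
  sumℚ {n} (λ _ → 0ℚ)  ≡⟨ sumℚ-const {n} 0ℚ ⟩
  ℕtoℚ n * 0ℚ          ≡⟨ ℚₚ.*-zeroʳ (ℕtoℚ n) ⟩
  0ℚ                   ≡⟨ ℚₚ.*-zeroʳ (ℕtoℚ B) ⟨
  ℕtoℚ B * 0ℚ          ∎
  where open ℚₚ.≤-Reasoning
sumℚ-weightAt-≤ ((I , w) ∷ f) {B} (I≤B ∷ f≤B) (0≤w ∷ 0≤f) = begin
  sumℚ (λ v → (if I v then w else 0ℚ) + weightAt f v)  ≡⟨ sumℚ-+ (λ v → if I v then w else 0ℚ) (weightAt f) ⟩
  sumOver I (λ _ → w) + sumℚ (weightAt f)              ≡⟨ cong (_+ sumℚ (weightAt f)) (sumOver-const I w) ⟩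
  ℕtoℚ (size I) * w + sumℚ (weightAt f)                ≤⟨ ℚₚ.+-mono-≤ (ℚₚ.*-monoʳ-≤-nonNeg w {{ℚ.nonNegative 0≤w}} (ℕtoℚ-mono-≤ I≤B))
                                                                      (sumℚ-weightAt-≤ f f≤B 0≤f) ⟩
  ℕtoℚ B * w + ℕtoℚ B * totalWeight f                  ≡⟨ ℚₚ.*-distribˡ-+ (ℕtoℚ B) w (totalWeight f) ⟨
  ℕtoℚ B * (w + totalWeight f)                         ∎
  where open ℚₚ.≤-Reasoning

fracColouring-bound : ∀ {n} {adj : Adj n} {f} {B} → IsFracColouring adj f →
  (∀ I → IsIndependent adj I → size I ℕ.≤ B) → ℕtoℚ n ≤ ℕtoℚ B * totalWeight f
fracColouring-bound {n} {f = f} {B} colouring bound = begin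
  ℕtoℚ n                      ≡⟨ ℚₚ.*-identityʳ (ℕtoℚ n) ⟨
  ℕtoℚ n * 1ℚ                 ≡⟨ sumℚ-const {n} 1ℚ ⟨
  sumℚ {n} (λ _ → 1ℚ)         ≤⟨ sumℚ-mono-≤ covers ⟩
  sumℚ (weightAt f)           ≤⟨ sumℚ-weightAt-≤ f {B} (All.map (λ {p} → bound (proj₁ p)) independent) nonneg ⟩
  ℕtoℚ B * totalWeight f      ∎
  where
  open ℚₚ.≤-Reasoning
  open IsFracColouring colouring

uniform-fracClique : ∀ {n} (adj : Adj n) {B} → 1 ℕ.≤ B →
  (∀ I → IsIndependent adj I → size I ℕ.≤ B) → ∃[ x ] (IsFracClique adj x × ℕtoℚ n ≤ ℕtoℚ B * sumℚ x)
uniform-fracClique {n} adj {B} 1≤B bound = (λ _ → r) , fracClique , ℚₚ.≤-reflexive total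
  where
  inverse = ℕtoℚ-inverse 1≤B
  r = proj₁ inverse
  0≤r = proj₁ (proj₂ inverse)
  Br≡1 = proj₂ (proj₂ inverse)
  fracClique : IsFracClique adj (λ _ → r)
  fracClique = record
    { nonneg  = λ _ → 0≤r
    ; bounded = λ I independent → begin
        sumOver I (λ _ → r)   ≡⟨ sumOver-const I r ⟩
        ℕtoℚ (size I) * r     ≤⟨ ℚₚ.*-monoʳ-≤-nonNeg r {{ℚ.nonNegative 0≤r}} (ℕtoℚ-mono-≤ (bound I independent)) ⟩
        ℕtoℚ B * r            ≡⟨ Br≡1 ⟩
        1ℚ                    ∎
    }
    where open ℚₚ.≤-Reasoning
  total : ℕtoℚ n ≡ ℕtoℚ B * sumℚ {n} (λ _ → r)
  total = begin-equality
    ℕtoℚ n                  ≡⟨ ℚₚ.*-identityʳ (ℕtoℚ n) ⟨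
    ℕtoℚ n * 1ℚ             ≡⟨ cong (ℕtoℚ n *_) Br≡1 ⟨
    ℕtoℚ n * (ℕtoℚ B * r)   ≡⟨ *-left-comm (ℕtoℚ n) (ℕtoℚ B) r ⟩
    ℕtoℚ B * (ℕtoℚ n * r)   ≡⟨ cong (ℕtoℚ B *_) (sumℚ-const {n} r) ⟨
    ℕtoℚ B * sumℚ {n} (λ _ → r) ∎
    where open ℚₚ.≤-Reasoning

-- Neighbourhood counts

neighboursIn : ∀ {n} → Adj n → VSet n → Fin n → ℕ
neighboursIn adj S v = sum (λ w → ⟦ S w ⟧ ℕ.* ⟦ adj v w ⟧)

codegree : ∀ {n} → Adj n → Fin n → Fin n → ℕ
codegree adj u = neighboursIn adj (adj u)

common≡codegree : ∀ {n} (adj : Adj n) u v → common adj u v ≡ codegree adj u v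
common≡codegree adj u v = trans (count≡sum (λ w → adj u w ∧ adj v w)) (sum-cong-≗ (λ w → ⟦∧⟧ (adj u w) (adj v w)))

sum-*-neighboursIn : ∀ {n} (adj : Adj n) S (g : Fin n → ℕ) →
  sum (λ v → g v ℕ.* neighboursIn adj S v)
    ≡ sum (λ w → ⟦ S w ⟧ ℕ.* sum (λ v → g v ℕ.* ⟦ adj v w ⟧))
sum-*-neighboursIn adj S g = begin
  sum (λ v → g v ℕ.* sum (λ w → ⟦ S w ⟧ ℕ.* ⟦ adj v w ⟧))
    ≡⟨ sum-cong-≗ (λ v → *-distribˡ-sum (g v) (λ w → ⟦ S w ⟧ ℕ.* ⟦ adj v w ⟧)) ⟩
  sum (λ v → sum (λ w → g v ℕ.* (⟦ S w ⟧ ℕ.* ⟦ adj v w ⟧)))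
    ≡⟨ ∑-comm (λ v w → g v ℕ.* (⟦ S w ⟧ ℕ.* ⟦ adj v w ⟧)) ⟩
  sum (λ w → sum (λ v → g v ℕ.* (⟦ S w ⟧ ℕ.* ⟦ adj v w ⟧)))
    ≡⟨ sum-cong-≗ (λ w → sum-cong-≗ (λ v → x∙yz≈y∙xz (g v) ⟦ S w ⟧ ⟦ adj v w ⟧)) ⟩
  sum (λ w → sum (λ v → ⟦ S w ⟧ ℕ.* (g v ℕ.* ⟦ adj v w ⟧)))
    ≡⟨ sum-cong-≗ (λ w → *-distribˡ-sum ⟦ S w ⟧ (λ v → g v ℕ.* ⟦ adj v w ⟧)) ⟨
  sum (λ w → ⟦ S w ⟧ ℕ.* sum (λ v → g v ℕ.* ⟦ adj v w ⟧)) ∎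
  where open ≡-Reasoning

module Regular {n d} {adj : Adj n} (simple : IsSimpleGraph adj) (regular : ∀ v → count (adj v) ≡ d) where
  open IsSimpleGraph simple
  open ≡-Reasoning

  degree : ∀ w → sum (λ v → ⟦ adj v w ⟧) ≡ d
  degree w = begin
    sum (λ v → ⟦ adj v w ⟧)  ≡⟨ sum-cong-≗ (λ v → cong ⟦_⟧ (symmetric v w)) ⟩
    sum (λ v → ⟦ adj w v ⟧)  ≡⟨ count≡sum (adj w) ⟨
    count (adj w)            ≡⟨ regular w ⟩
    d                        ∎

  sum-adjacent-* : ∀ u x → sum (λ v → ⟦ adj u v ⟧ ℕ.* x) ≡ d ℕ.* x
  sum-adjacent-* u x = begin
    sum (λ v → ⟦ adj u v ⟧ ℕ.* x)  ≡⟨ *-distribʳ-sum x (λ v → ⟦ adj u v ⟧) ⟨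
    sum (λ v → ⟦ adj u v ⟧) ℕ.* x  ≡⟨ cong (ℕ._* x) (trans (sym (count≡sum (adj u))) (regular u)) ⟩
    d ℕ.* x                        ∎

  sum-neighboursIn : ∀ S → sum (neighboursIn adj S) ≡ size S ℕ.* d
  sum-neighboursIn S = begin
    sum (neighboursIn adj S)
      ≡⟨ sum-cong-≗ (λ v → ℕₚ.*-identityˡ (neighboursIn adj S v)) ⟨
    sum (λ v → 1 ℕ.* neighboursIn adj S v)
      ≡⟨ sum-*-neighboursIn adj S (λ _ → 1) ⟩
    sum (λ w → ⟦ S w ⟧ ℕ.* sum (λ v → 1 ℕ.* ⟦ adj v w ⟧))
      ≡⟨ sum-cong-≗ (λ w → cong (⟦ S w ⟧ ℕ.*_)
           (trans (sum-cong-≗ (λ v → ℕₚ.*-identityˡ ⟦ adj v w ⟧)) (degree w))) ⟩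
    sum (λ w → ⟦ S w ⟧ ℕ.* d)
      ≡⟨ *-distribʳ-sum d (λ w → ⟦ S w ⟧) ⟨
    sum (λ w → ⟦ S w ⟧) ℕ.* d
      ≡⟨ cong (ℕ._* d) (count≡sum S) ⟨
    size S ℕ.* d ∎

  codegree-self : ∀ v → codegree adj v v ≡ d
  codegree-self v = begin
    sum (λ w → ⟦ adj v w ⟧ ℕ.* ⟦ adj v w ⟧)  ≡⟨ sum-cong-≗ (λ w → idempotent (adj v w)) ⟩
    sum (λ w → ⟦ adj v w ⟧)                  ≡⟨ count≡sum (adj v) ⟨
    count (adj v)                            ≡⟨ regular v ⟩
    d                                        ∎
    where
    idempotent : ∀ b → ⟦ b ⟧ ℕ.* ⟦ b ⟧ ≡ ⟦ b ⟧
    idempotent true  = refl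
    idempotent false = refl

  sum-neighboursIn² : ∀ S →
    sum (λ v → neighboursIn adj S v ℕ.* neighboursIn adj S v)
      ≡ sum (λ w → ⟦ S w ⟧ ℕ.* sum (λ w′ → ⟦ S w′ ⟧ ℕ.* codegree adj w w′))
  sum-neighboursIn² S = trans (sum-*-neighboursIn adj S k) (sum-cong-≗ (λ w → cong (⟦ S w ⟧ ℕ.*_) (inner w)))
    where
    k = neighboursIn adj S
    inner : ∀ w → sum (λ v → k v ℕ.* ⟦ adj v w ⟧) ≡ sum (λ w′ → ⟦ S w′ ⟧ ℕ.* codegree adj w w′)
    inner w = begin
      sum (λ v → k v ℕ.* ⟦ adj v w ⟧)
        ≡⟨ sum-cong-≗ (λ v → trans (ℕₚ.*-comm (k v) _) (cong (λ b → ⟦ b ⟧ ℕ.* k v) (symmetric v w))) ⟩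
      sum (λ v → ⟦ adj w v ⟧ ℕ.* k v)
        ≡⟨ sum-*-neighboursIn adj S (λ v → ⟦ adj w v ⟧) ⟩
      sum (λ w′ → ⟦ S w′ ⟧ ℕ.* sum (λ v → ⟦ adj w v ⟧ ℕ.* ⟦ adj v w′ ⟧))
        ≡⟨ sum-cong-≗ (λ w′ → cong (⟦ S w′ ⟧ ℕ.*_) (sum-cong-≗ (λ v → cong (λ b → ⟦ adj w v ⟧ ℕ.* ⟦ b ⟧) (symmetric v w′)))) ⟩
      sum (λ w′ → ⟦ S w′ ⟧ ℕ.* codegree adj w w′) ∎

  sum-neighboursIn²-uniform : ∀ S ε →
    (∀ w w′ → S w ≡ true → S w′ ≡ true → w ≢ w′ → codegree adj w w′ ≡ ε) →
    sum (λ v → neighboursIn adj S v ℕ.* neighboursIn adj S v) ℕ.+ size S ℕ.* ε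
      ≡ size S ℕ.* (size S ℕ.* ε ℕ.+ d)
  sum-neighboursIn²-uniform S ε uniform = begin
    sum (λ v → neighboursIn adj S v ℕ.* neighboursIn adj S v) ℕ.+ size S ℕ.* ε
      ≡⟨ cong₂ ℕ._+_ (sum-neighboursIn² S)
           (trans (cong (ℕ._* ε) (count≡sum S)) (*-distribʳ-sum ε (λ w → ⟦ S w ⟧))) ⟩
    sum (λ w → ⟦ S w ⟧ ℕ.* row w) ℕ.+ sum (λ w → ⟦ S w ⟧ ℕ.* ε)
      ≡⟨ ∑-distrib-+ (λ w → ⟦ S w ⟧ ℕ.* row w) (λ w → ⟦ S w ⟧ ℕ.* ε) ⟨
    sum (λ w → ⟦ S w ⟧ ℕ.* row w ℕ.+ ⟦ S w ⟧ ℕ.* ε)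
      ≡⟨ sum-cong-≗ rows ⟩
    sum (λ w → ⟦ S w ⟧ ℕ.* (size S ℕ.* ε ℕ.+ d))
      ≡⟨ *-distribʳ-sum (size S ℕ.* ε ℕ.+ d) (λ w → ⟦ S w ⟧) ⟨
    sum (λ w → ⟦ S w ⟧) ℕ.* (size S ℕ.* ε ℕ.+ d)
      ≡⟨ cong (ℕ._* (size S ℕ.* ε ℕ.+ d)) (count≡sum S) ⟨
    size S ℕ.* (size S ℕ.* ε ℕ.+ d) ∎
    where
    row : Fin n → ℕ
    row w = sum (λ w′ → ⟦ S w′ ⟧ ℕ.* codegree adj w w′)

    row+ε : ∀ w → S w ≡ true → row w ℕ.+ ε ≡ size S ℕ.* ε ℕ.+ d
    row+ε w Sw = begin
      row w ℕ.+ ε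
        ≡⟨ cong (row w ℕ.+_) (sum-δ w (λ _ → ε)) ⟨
      row w ℕ.+ sum (λ w′ → δ w w′ ℕ.* ε)
        ≡⟨ ∑-distrib-+ (λ w′ → ⟦ S w′ ⟧ ℕ.* codegree adj w w′) (λ w′ → δ w w′ ℕ.* ε) ⟨
      sum (λ w′ → ⟦ S w′ ⟧ ℕ.* codegree adj w w′ ℕ.+ δ w w′ ℕ.* ε)
        ≡⟨ sum-cong-≗ entry ⟩
      sum (λ w′ → ⟦ S w′ ⟧ ℕ.* ε ℕ.+ δ w w′ ℕ.* d)
        ≡⟨ ∑-distrib-+ (λ w′ → ⟦ S w′ ⟧ ℕ.* ε) (λ w′ → δ w w′ ℕ.* d) ⟩
      sum (λ w′ → ⟦ S w′ ⟧ ℕ.* ε) ℕ.+ sum (λ w′ → δ w w′ ℕ.* d)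
        ≡⟨ cong₂ ℕ._+_ (trans (sym (*-distribʳ-sum ε (λ w′ → ⟦ S w′ ⟧))) (cong (ℕ._* ε) (sym (count≡sum S)))) (sum-δ w (λ _ → d)) ⟩
      size S ℕ.* ε ℕ.+ d ∎
      where
      entry : ∀ w′ → ⟦ S w′ ⟧ ℕ.* codegree adj w w′ ℕ.+ δ w w′ ℕ.* ε ≡ ⟦ S w′ ⟧ ℕ.* ε ℕ.+ δ w w′ ℕ.* d
      entry w′ with w ≟ w′
      ... | yes refl rewrite Sw | codegree-self w = ℕₚ.+-comm (1 ℕ.* d) (1 ℕ.* ε)
      ... | no w≢w′ with S w′ in Sw′
      ...   | true  = cong (λ x → 1 ℕ.* x ℕ.+ 0) (uniform w w′ Sw Sw′ w≢w′)
      ...   | false = refl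

    rows : ∀ w → ⟦ S w ⟧ ℕ.* row w ℕ.+ ⟦ S w ⟧ ℕ.* ε ≡ ⟦ S w ⟧ ℕ.* (size S ℕ.* ε ℕ.+ d)
    rows w with S w in Sw
    ... | true  = trans (sym (ℕₚ.*-distribˡ-+ 1 (row w) ε)) (cong (1 ℕ.*_) (row+ε w Sw))
    ... | false = refl

-- Strongly regular graphs

private
  scaled-square : ∀ a x N y → a ℕ.* (a ℕ.* (x ℕ.* x) ℕ.+ N ℕ.* y) ≡ (a ℕ.* x) ℕ.* (a ℕ.* x) ℕ.+ N ℕ.* (a ℕ.* y)
  scaled-square = ℕ-Solver.solve-∀

  suc-split : ∀ b l d → suc b ℕ.* (suc b ℕ.* l ℕ.+ d) ≡ suc b ℕ.* (b ℕ.* l ℕ.+ d) ℕ.+ suc b ℕ.* l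
  suc-split = ℕ-Solver.solve-∀

  diagonal-case : ∀ x y z → x ℕ.+ 1 ℕ.* z ℕ.+ 0 ℕ.* z ≡ 1 ℕ.* x ℕ.+ 0 ℕ.* y ℕ.+ z
  diagonal-case = ℕ-Solver.solve-∀

  adjacent-case : ∀ x y z → y ℕ.+ 0 ℕ.* z ℕ.+ 1 ℕ.* z ≡ 0 ℕ.* x ℕ.+ 1 ℕ.* y ℕ.+ z
  adjacent-case = ℕ-Solver.solve-∀

  nonadjacent-case : ∀ x y z → z ℕ.+ 0 ℕ.* z ℕ.+ 0 ℕ.* z ≡ 0 ℕ.* x ℕ.+ 0 ℕ.* y ℕ.+ z
  nonadjacent-case = ℕ-Solver.solve-∀

-- The last factor on each right-hand side is the defect of parameter-identity below
-- (with n = M + A, resp. n = M + (1 + B)), so it vanishes for a strongly regular graph.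
srg-independent-form : ∀ M A d μ l →
  (d - μ) * M * M + d * (μ - l) * M * A - d * d * A * A
    ≡ (M + A) * (M * (A * μ + d) - (A * (d * d) + M * μ))
      - M * A * ((d + d * l + (M + A) * μ) - (d * d + μ + d * μ))
srg-independent-form = solve-∀ ℚ-ring

srg-clique-form : ∀ M B d μ l →
  (d - l - 1ℚ) * (0ℚ - ((d - μ) * ((1ℚ + B) - 1ℚ) * ((1ℚ + B) - 1ℚ)
                        + d * (μ - l) * ((1ℚ + B) - 1ℚ) * 1ℚ - d * d * 1ℚ * 1ℚ))
    ≡ μ * (M * (B * l + d) - ((1ℚ + B) * ((d - B) * (d - B)) + M * (B * B)))
      - (d + B * l - B * B) * ((d + d * l + (M + (1ℚ + B)) * μ) - (d * d + μ + d * μ))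
srg-clique-form = solve-∀ ℚ-ring

sub-2+-add-1 : ∀ d l → d - (ℕtoℚ 2 + l) + 1ℚ ≡ d - l - 1ℚ
sub-2+-add-1 = solve-∀ ℚ-ring

srg-clique-form-degenerate : ∀ B d μ l →
  (d - B) * ((d - μ) * B + d) + d * B * ((1ℚ + l) - d)
    ≡ 0ℚ - ((d - μ) * ((1ℚ + B) - 1ℚ) * ((1ℚ + B) - 1ℚ)
            + d * (μ - l) * ((1ℚ + B) - 1ℚ) * 1ℚ - d * d * 1ℚ * 1ℚ)
srg-clique-form-degenerate = solve-∀ ℚ-ring

module StronglyRegular {n d lam mu} {adj : Adj n} (srg : IsSRG n d lam mu adj) where
  open IsSRG srg
  open IsSimpleGraph simple
  open Regular simple regular public

  codegree-decomposition : ∀ u v →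
    codegree adj u v ℕ.+ δ u v ℕ.* mu ℕ.+ ⟦ adj u v ⟧ ℕ.* mu ≡ δ u v ℕ.* d ℕ.+ ⟦ adj u v ⟧ ℕ.* lam ℕ.+ mu
  codegree-decomposition u v with u ≟ v
  ... | yes refl rewrite codegree-self u | irreflexive u = diagonal-case d lam mu
  ... | no u≢v with adj u v in uv
  ...   | true  rewrite trans (sym (common≡codegree adj u v)) (adjCommon u v uv) = adjacent-case d lam mu
  ...   | false rewrite trans (sym (common≡codegree adj u v)) (nonadjCommon u v u≢v uv) = nonadjacent-case d lam mu

  -- d (d − λ − 1) = (n − d − 1) μ, with the terms moved so that no subtraction occurs.
  parameter-identity : Fin n → d ℕ.* d ℕ.+ mu ℕ.+ d ℕ.* mu ≡ d ℕ.+ d ℕ.* lam ℕ.+ n ℕ.* mu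
  parameter-identity u = begin
    d ℕ.* d ℕ.+ mu ℕ.+ d ℕ.* mu
      ≡⟨ cong₂ (λ x y → x ℕ.+ mu ℕ.+ y) double-count (sym (sum-adjacent-* u mu)) ⟩
    sum (codegree adj u) ℕ.+ mu ℕ.+ sum (λ v → ⟦ adj u v ⟧ ℕ.* mu)
      ≡⟨ cong (λ x → sum (codegree adj u) ℕ.+ x ℕ.+ sum (λ v → ⟦ adj u v ⟧ ℕ.* mu)) (sum-δ u (λ _ → mu)) ⟨
    sum (codegree adj u) ℕ.+ sum (λ v → δ u v ℕ.* mu) ℕ.+ sum (λ v → ⟦ adj u v ⟧ ℕ.* mu)
      ≡⟨ ∑-distrib-+₃ (codegree adj u) (λ v → δ u v ℕ.* mu) (λ v → ⟦ adj u v ⟧ ℕ.* mu) ⟨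
    sum (λ v → codegree adj u v ℕ.+ δ u v ℕ.* mu ℕ.+ ⟦ adj u v ⟧ ℕ.* mu)
      ≡⟨ sum-cong-≗ (codegree-decomposition u) ⟩
    sum (λ v → δ u v ℕ.* d ℕ.+ ⟦ adj u v ⟧ ℕ.* lam ℕ.+ mu)
      ≡⟨ ∑-distrib-+₃ (λ v → δ u v ℕ.* d) (λ v → ⟦ adj u v ⟧ ℕ.* lam) (λ _ → mu) ⟩
    sum (λ v → δ u v ℕ.* d) ℕ.+ sum (λ v → ⟦ adj u v ⟧ ℕ.* lam) ℕ.+ sum {n} (λ _ → mu)
      ≡⟨ cong₂ ℕ._+_ (cong₂ ℕ._+_ (sum-δ u (λ _ → d)) (sum-adjacent-* u lam)) (sum-const {n} mu) ⟩
    d ℕ.+ d ℕ.* lam ℕ.+ n ℕ.* mu ∎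
    where
    open ≡-Reasoning
    double-count : d ℕ.* d ≡ sum (codegree adj u)
    double-count = trans (cong (ℕ._* d) (sym (regular u))) (sym (sum-neighboursIn (adj u)))

  neighboursIn-independent : ∀ {S} → IsIndependent adj S → ∀ v → S v ≡ true → neighboursIn adj S v ≡ 0
  neighboursIn-independent {S} independent v Sv =
    trans (sum-cong-≗ nonadjacent-in-S) (trans (sum-const {n} 0) (ℕₚ.*-zeroʳ n))
    where
    nonadjacent-in-S : ∀ w → ⟦ S w ⟧ ℕ.* ⟦ adj v w ⟧ ≡ 0
    nonadjacent-in-S w with S w in Sw
    ... | true  rewrite independent v w Sv Sw = refl
    ... | false = refl

  independent-inequality : ∀ {S} → IsIndependent adj S → 1 ℕ.≤ size S →
    size S ℕ.* (d ℕ.* d) ℕ.+ size (not ∘ S) ℕ.* mu ℕ.≤ size (not ∘ S) ℕ.* (size S ℕ.* mu ℕ.+ d)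
  independent-inequality {S} independent 1≤a = ℕₚ.*-cancelˡ-≤ a {{ℕ.>-nonZero 1≤a}} (begin
    a ℕ.* (a ℕ.* (d ℕ.* d) ℕ.+ N ℕ.* mu)        ≡⟨ scaled-square a d N mu ⟩
    (a ℕ.* d) ℕ.* (a ℕ.* d) ℕ.+ N ℕ.* (a ℕ.* mu) ≤⟨ ℕₚ.+-monoˡ-≤ (N ℕ.* (a ℕ.* mu)) cs ⟩
    N ℕ.* K ℕ.+ N ℕ.* (a ℕ.* mu)                ≡⟨ ℕₚ.*-distribˡ-+ N K (a ℕ.* mu) ⟨
    N ℕ.* (K ℕ.+ a ℕ.* mu)                      ≡⟨ cong (N ℕ.*_) pairs ⟩
    N ℕ.* (a ℕ.* (a ℕ.* mu ℕ.+ d))              ≡⟨ x∙yz≈y∙xz N a (a ℕ.* mu ℕ.+ d) ⟩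
    a ℕ.* (N ℕ.* (a ℕ.* mu ℕ.+ d))              ∎)
    where
    open ℕₚ.≤-Reasoning
    a = size S
    N = size (not ∘ S)
    k = neighboursIn adj S
    K = sum (λ v → k v ℕ.* k v)
    pairs : K ℕ.+ a ℕ.* mu ≡ a ℕ.* (a ℕ.* mu ℕ.+ d)
    pairs = sum-neighboursIn²-uniform S mu λ w w′ Sw Sw′ w≢w′ →
      trans (sym (common≡codegree adj w w′)) (nonadjCommon w w′ w≢w′ (independent w w′ Sw Sw′))
    cs : (a ℕ.* d) ℕ.* (a ℕ.* d) ℕ.≤ N ℕ.* K
    cs = subst₂ ℕ._≤_ (cong₂ ℕ._*_ outside outside) (cong₂ ℕ._*_ (sym (count≡sum (not ∘ S))) outside²)
      (cauchy-schwarz (λ v → ⟦ not (S v) ⟧) k)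
      where
      k≡0 = neighboursIn-independent independent
      outside = trans (sum-outside-vanishing S k k≡0) (sum-neighboursIn S)
      outside² = sum-outside-vanishing S (λ v → k v ℕ.* k v) (λ v Sv → cong (λ x → x ℕ.* x) (k≡0 v Sv))

  neighboursIn-clique : ∀ {K} → IsClique adj K → ∀ v → K v ≡ true → suc (neighboursIn adj K v) ≡ size K
  neighboursIn-clique {K} clique v Kv = begin
    suc (neighboursIn adj K v)
      ≡⟨ ℕₚ.+-comm 1 (neighboursIn adj K v) ⟩
    neighboursIn adj K v ℕ.+ 1
      ≡⟨ cong (neighboursIn adj K v ℕ.+_) (sum-δ v (λ _ → 1)) ⟨
    neighboursIn adj K v ℕ.+ sum (λ w → δ v w ℕ.* 1)
      ≡⟨ ∑-distrib-+ (λ w → ⟦ K w ⟧ ℕ.* ⟦ adj v w ⟧) (λ w → δ v w ℕ.* 1) ⟨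
    sum (λ w → ⟦ K w ⟧ ℕ.* ⟦ adj v w ⟧ ℕ.+ δ v w ℕ.* 1)
      ≡⟨ sum-cong-≗ member ⟩
    sum (λ w → ⟦ K w ⟧)
      ≡⟨ count≡sum K ⟨
    size K ∎
    where
    open ≡-Reasoning
    member : ∀ w → ⟦ K w ⟧ ℕ.* ⟦ adj v w ⟧ ℕ.+ δ v w ℕ.* 1 ≡ ⟦ K w ⟧
    member w with v ≟ w
    ... | yes refl rewrite Kv | irreflexive v = refl
    ... | no v≢w with K w in Kw
    ...   | true  rewrite clique v w v≢w Kv Kw = refl
    ...   | false = refl

  module _ {K b} (clique : IsClique adj K) (size≡ : size K ≡ suc b) where
    private
      w = size K
      N = size (not ∘ K)
      k = neighboursIn adj K
      F = sum (λ v → ⟦ not (K v) ⟧ ℕ.* k v)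

      k≡b : ∀ v → K v ≡ true → k v ≡ b
      k≡b v Kv = ℕₚ.suc-injective (trans (neighboursIn-clique clique v Kv) size≡)

      outside : F ℕ.+ w ℕ.* b ≡ w ℕ.* d
      outside = trans (sum-outside K k b k≡b) (sum-neighboursIn K)

    clique-size-bound : b ℕ.≤ d
    clique-size-bound = ℕₚ.*-cancelˡ-≤ w {{nonZero}}
      (subst (w ℕ.* b ℕ.≤_) outside (ℕₚ.m≤n+m (w ℕ.* b) F))
      where
      nonZero : ℕ.NonZero w
      nonZero = subst ℕ.NonZero (sym size≡) _

    clique-inequality : ∀ {r} → b ℕ.+ r ≡ d →
      w ℕ.* (r ℕ.* r) ℕ.+ N ℕ.* (b ℕ.* b) ℕ.≤ N ℕ.* (b ℕ.* lam ℕ.+ d)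
    clique-inequality {r} b+r≡d = ℕₚ.*-cancelˡ-≤ w {{nonZero}} (begin
      w ℕ.* (w ℕ.* (r ℕ.* r) ℕ.+ N ℕ.* (b ℕ.* b))    ≡⟨ scaled-square w r N (b ℕ.* b) ⟩
      (w ℕ.* r) ℕ.* (w ℕ.* r) ℕ.+ N ℕ.* (w ℕ.* (b ℕ.* b)) ≤⟨ ℕₚ.+-monoˡ-≤ (N ℕ.* (w ℕ.* (b ℕ.* b))) cs ⟩
      N ℕ.* Q ℕ.+ N ℕ.* (w ℕ.* (b ℕ.* b))            ≡⟨ ℕₚ.*-distribˡ-+ N Q (w ℕ.* (b ℕ.* b)) ⟨
      N ℕ.* (Q ℕ.+ w ℕ.* (b ℕ.* b))                  ≡⟨ cong (N ℕ.*_) (trans outside² K²≡) ⟩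
      N ℕ.* (w ℕ.* (b ℕ.* lam ℕ.+ d))                ≡⟨ x∙yz≈y∙xz N w (b ℕ.* lam ℕ.+ d) ⟩
      w ℕ.* (N ℕ.* (b ℕ.* lam ℕ.+ d))                ∎)
      where
      open ℕₚ.≤-Reasoning
      nonZero : ℕ.NonZero w
      nonZero = subst ℕ.NonZero (sym size≡) _
      Q = sum (λ v → ⟦ not (K v) ⟧ ℕ.* (k v ℕ.* k v))
      K² = sum (λ v → k v ℕ.* k v)
      outside² : Q ℕ.+ w ℕ.* (b ℕ.* b) ≡ K²
      outside² = sum-outside K (λ v → k v ℕ.* k v) (b ℕ.* b) (λ v Kv → cong (λ x → x ℕ.* x) (k≡b v Kv))
      pairs : K² ℕ.+ w ℕ.* lam ≡ w ℕ.* (w ℕ.* lam ℕ.+ d)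
      pairs = sum-neighboursIn²-uniform K lam λ u u′ Ku Ku′ u≢u′ →
        trans (sym (common≡codegree adj u u′)) (adjCommon u u′ (clique u u′ u≢u′ Ku Ku′))
      K²≡ : K² ≡ w ℕ.* (b ℕ.* lam ℕ.+ d)
      K²≡ = ℕₚ.+-cancelʳ-≡ (w ℕ.* lam) K² (w ℕ.* (b ℕ.* lam ℕ.+ d)) (begin-equality
        K² ℕ.+ w ℕ.* lam                              ≡⟨ pairs ⟩
        w ℕ.* (w ℕ.* lam ℕ.+ d)                        ≡⟨ cong (λ x → x ℕ.* (x ℕ.* lam ℕ.+ d)) size≡ ⟩
        suc b ℕ.* (suc b ℕ.* lam ℕ.+ d)                ≡⟨ suc-split b lam d ⟩
        suc b ℕ.* (b ℕ.* lam ℕ.+ d) ℕ.+ suc b ℕ.* lam  ≡⟨ cong (λ x → x ℕ.* (b ℕ.* lam ℕ.+ d) ℕ.+ x ℕ.* lam) size≡ ⟨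
        w ℕ.* (b ℕ.* lam ℕ.+ d) ℕ.+ w ℕ.* lam          ∎)
      F≡ : F ≡ w ℕ.* r
      F≡ = ℕₚ.+-cancelʳ-≡ (w ℕ.* b) F (w ℕ.* r) (begin-equality
        F ℕ.+ w ℕ.* b            ≡⟨ outside ⟩
        w ℕ.* d                  ≡⟨ cong (w ℕ.*_) b+r≡d ⟨
        w ℕ.* (b ℕ.+ r)          ≡⟨ ℕₚ.*-distribˡ-+ w b r ⟩
        w ℕ.* b ℕ.+ w ℕ.* r      ≡⟨ ℕₚ.+-comm (w ℕ.* b) (w ℕ.* r) ⟩
        w ℕ.* r ℕ.+ w ℕ.* b      ∎)
      cs : (w ℕ.* r) ℕ.* (w ℕ.* r) ℕ.≤ N ℕ.* Q
      cs = subst₂ ℕ._≤_ (cong₂ ℕ._*_ F≡ F≡) (cong (ℕ._* Q) (sym (count≡sum (not ∘ K))))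
        (cauchy-schwarz (λ v → ⟦ not (K v) ⟧) k)

  vertex : Fin n
  vertex = proj₁ notComplete

  1≤d : 1 ℕ.≤ d
  1≤d with notEdgeless
  ... | u , v , uv = subst (1 ℕ.≤_) (trans (sym (count≡sum (adj u))) (regular u))
    (subst (ℕ._≤ sum (λ w → ⟦ adj u w ⟧)) (cong ⟦_⟧ uv) (term≤sum (λ w → ⟦ adj u w ⟧) v))

  mu≤d : mu ℕ.≤ d
  mu≤d with notComplete
  ... | u , v , u≢v , uv = subst₂ ℕ._≤_
    (trans (sym (common≡codegree adj u v)) (nonadjCommon u v u≢v uv))
    (trans (sym (count≡sum (adj u))) (regular u))
    (sum-mono-≤ (λ w → ⟦⟧*⟦⟧≤⟦⟧ (adj u w) (adj v w)))

  size≤n : ∀ S → size S ℕ.≤ n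
  size≤n S = subst (size S ℕ.≤_) (size-complement S) (ℕₚ.m≤n+m (size S) (size (not ∘ S)))

  private
    nℚ dℚ lamℚ muℚ : ℚ
    nℚ = ℕtoℚ n
    dℚ = ℕtoℚ d
    lamℚ = ℕtoℚ lam
    muℚ = ℕtoℚ mu

    0≤d-mu : 0ℚ ≤ dℚ - muℚ
    0≤d-mu = p≤q⇒0≤q-p (ℕtoℚ-mono-≤ mu≤d)

  open BinaryForm (dℚ - muℚ) (muℚ - lamℚ) dℚ 0≤d-mu (ℕtoℚ-pos 1≤d) public

  parameter-defect : ∀ {M} → nℚ ≡ M →
    (dℚ + dℚ * lamℚ + M * muℚ) - (dℚ * dℚ + muℚ + dℚ * muℚ) ≡ 0ℚ
  parameter-defect n≡M = subst (λ M → (dℚ + dℚ * lamℚ + M * muℚ) - (dℚ * dℚ + muℚ + dℚ * muℚ) ≡ 0ℚ) n≡M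
    (trans (cong (_- (dℚ * dℚ + muℚ + dℚ * muℚ)) (sym identityℚ)) (ℚₚ.+-inverseʳ (dℚ * dℚ + muℚ + dℚ * muℚ)))
    where
    identityℚ : dℚ * dℚ + muℚ + dℚ * muℚ ≡ dℚ + dℚ * lamℚ + nℚ * muℚ
    identityℚ = begin
      dℚ * dℚ + muℚ + dℚ * muℚ
        ≡⟨ cong₂ (λ x y → x + muℚ + y) (ℕtoℚ-* d d) (ℕtoℚ-* d mu) ⟨
      ℕtoℚ (d ℕ.* d) + muℚ + ℕtoℚ (d ℕ.* mu)
        ≡⟨ trans (ℕtoℚ-+ (d ℕ.* d ℕ.+ mu) (d ℕ.* mu)) (cong (_+ ℕtoℚ (d ℕ.* mu)) (ℕtoℚ-+ (d ℕ.* d) mu)) ⟨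
      ℕtoℚ (d ℕ.* d ℕ.+ mu ℕ.+ d ℕ.* mu)
        ≡⟨ cong ℕtoℚ (parameter-identity vertex) ⟩
      ℕtoℚ (d ℕ.+ d ℕ.* lam ℕ.+ n ℕ.* mu)
        ≡⟨ trans (ℕtoℚ-+ (d ℕ.+ d ℕ.* lam) (n ℕ.* mu)) (cong (_+ ℕtoℚ (n ℕ.* mu)) (ℕtoℚ-+ d (d ℕ.* lam))) ⟩
      dℚ + ℕtoℚ (d ℕ.* lam) + ℕtoℚ (n ℕ.* mu)
        ≡⟨ cong₂ (λ x y → dℚ + x + y) (ℕtoℚ-* d lam) (ℕtoℚ-* n mu) ⟩
      dℚ + dℚ * lamℚ + nℚ * muℚ ∎
      where open ≡-Reasoning

  nℚ≡ : ∀ S → nℚ ≡ ℕtoℚ (size (not ∘ S)) + ℕtoℚ (size S)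
  nℚ≡ S = trans (cong ℕtoℚ (sym (size-complement {n} S))) (ℕtoℚ-+ (size (not ∘ S)) (size S))

  independent⇒form-nonNeg : ∀ {S} → IsIndependent adj S → 1 ℕ.≤ size S →
    0ℚ ≤ form (nℚ - ℕtoℚ (size S)) (ℕtoℚ (size S))
  independent⇒form-nonNeg {S} independent 1≤a = subst (λ p → 0ℚ ≤ form p A) (sym n-A≡M)
    (subst (0ℚ ≤_) (sym form≡) (*-nonNeg (+-nonNeg (ℕtoℚ-nonNeg N) (ℕtoℚ-nonNeg a)) (p≤q⇒0≤q-p inequality)))
    where
    a N : ℕ
    a = size S
    N = size (not ∘ S)
    A M : ℚ
    A = ℕtoℚ a
    M = ℕtoℚ N
    n-A≡M : nℚ - A ≡ M
    n-A≡M = trans (cong (_- A) (nℚ≡ S)) (add-sub-cancel M A)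
    inequality : A * (dℚ * dℚ) + M * muℚ ≤ M * (A * muℚ + dℚ)
    inequality = subst₂ _≤_
      (trans (ℕtoℚ-+ (a ℕ.* (d ℕ.* d)) (N ℕ.* mu))
             (cong₂ _+_ (trans (ℕtoℚ-* a (d ℕ.* d)) (cong (A *_) (ℕtoℚ-* d d))) (ℕtoℚ-* N mu)))
      (trans (ℕtoℚ-* N (a ℕ.* mu ℕ.+ d)) (cong (M *_) (trans (ℕtoℚ-+ (a ℕ.* mu) d) (cong (_+ dℚ) (ℕtoℚ-* a mu)))))
      (ℕtoℚ-mono-≤ (independent-inequality independent 1≤a))
    form≡ : form M A ≡ (M + A) * (M * (A * muℚ + dℚ) - (A * (dℚ * dℚ) + M * muℚ))
    form≡ = trans (srg-independent-form M A dℚ muℚ lamℚ)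
      (trans (cong (λ e → (M + A) * (M * (A * muℚ + dℚ) - (A * (dℚ * dℚ) + M * muℚ)) - M * A * e)
                   (parameter-defect (nℚ≡ S)))
             (sub-*-zero ((M + A) * (M * (A * muℚ + dℚ) - (A * (dℚ * dℚ) + M * muℚ))) (M * A)))

  module _ {K b} (clique : IsClique adj K) (size≡ : size K ≡ suc b) where
    private
      N r : ℕ
      N = size (not ∘ K)
      r = d ℕ.∸ b
      B M : ℚ
      B = ℕtoℚ b
      M = ℕtoℚ N
      b≤d : b ℕ.≤ d
      b≤d = clique-size-bound clique size≡
      W≡ : ℕtoℚ (size K) ≡ 1ℚ + B
      W≡ = trans (cong ℕtoℚ size≡) (ℕtoℚ-+ 1 b)
      R≡ : ℕtoℚ r ≡ dℚ - B
      R≡ = trans (sym (add-sub-cancelˡ B (ℕtoℚ r)))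
                 (cong (_- B) (trans (sym (ℕtoℚ-+ b r)) (cong ℕtoℚ (ℕₚ.m+[n∸m]≡n b≤d))))

      inequality : (1ℚ + B) * ((dℚ - B) * (dℚ - B)) + M * (B * B) ≤ M * (B * lamℚ + dℚ)
      inequality = subst₂ _≤_
        (trans (ℕtoℚ-+ (size K ℕ.* (r ℕ.* r)) (N ℕ.* (b ℕ.* b))) (cong₂ _+_
          (trans (ℕtoℚ-* (size K) (r ℕ.* r)) (cong₂ _*_ W≡ (trans (ℕtoℚ-* r r) (cong₂ _*_ R≡ R≡))))
          (trans (ℕtoℚ-* N (b ℕ.* b)) (cong (M *_) (ℕtoℚ-* b b)))))
        (trans (ℕtoℚ-* N (b ℕ.* lam ℕ.+ d)) (cong (M *_) (trans (ℕtoℚ-+ (b ℕ.* lam) d) (cong (_+ dℚ) (ℕtoℚ-* b lam)))))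
        (ℕtoℚ-mono-≤ (clique-inequality clique size≡ (ℕₚ.m+[n∸m]≡n b≤d)))

      -- Divide the identity srg-clique-form by d − λ − 1 > 0.
      0≤-form-generic : suc (suc lam) ℕ.≤ d → 0ℚ ≤ 0ℚ - form ((1ℚ + B) - 1ℚ) 1ℚ
      0≤-form-generic λ+2≤d = *-cancelˡ-nonNeg 0<d-λ-1
        (subst (0ℚ ≤_) (sym form≡) (*-nonNeg (ℕtoℚ-nonNeg mu) (p≤q⇒0≤q-p inequality)))
        where
        0<d-λ-1 : 0ℚ < dℚ - lamℚ - 1ℚ
        0<d-λ-1 = subst (0ℚ <_) (sub-2+-add-1 dℚ lamℚ)
          (ℚₚ.+-mono-≤-< (p≤q⇒0≤q-p (subst (_≤ dℚ) (ℕtoℚ-+ 2 lam) (ℕtoℚ-mono-≤ λ+2≤d))) (ℚₚ.positive⁻¹ 1ℚ))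
        T : ℚ
        T = M * (B * lamℚ + dℚ) - ((1ℚ + B) * ((dℚ - B) * (dℚ - B)) + M * (B * B))
        form≡ : (dℚ - lamℚ - 1ℚ) * (0ℚ - form ((1ℚ + B) - 1ℚ) 1ℚ) ≡ muℚ * T
        form≡ = trans (srg-clique-form M B dℚ muℚ lamℚ)
          (trans (cong (λ e → muℚ * T - (dℚ + B * lamℚ - B * B) * e)
                       (parameter-defect (trans (nℚ≡ K) (cong (M +_) W≡))))
                 (sub-*-zero (muℚ * T) (dℚ + B * lamℚ - B * B)))

      0≤-form-degenerate : d ℕ.≤ suc lam → 0ℚ ≤ 0ℚ - form ((1ℚ + B) - 1ℚ) 1ℚ
      0≤-form-degenerate d≤λ+1 = subst (0ℚ ≤_) (srg-clique-form-degenerate B dℚ muℚ lamℚ)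
        (+-nonNeg (*-nonNeg (p≤q⇒0≤q-p (ℕtoℚ-mono-≤ b≤d))
                            (+-nonNeg (*-nonNeg 0≤d-mu (ℕtoℚ-nonNeg b)) (ℕtoℚ-nonNeg d)))
                  (*-nonNeg (*-nonNeg (ℕtoℚ-nonNeg d) (ℕtoℚ-nonNeg b))
                            (p≤q⇒0≤q-p (subst (dℚ ≤_) (ℕtoℚ-+ 1 lam) (ℕtoℚ-mono-≤ d≤λ+1)))))

      0≤-form : Dec (suc (suc lam) ℕ.≤ d) → 0ℚ ≤ 0ℚ - form ((1ℚ + B) - 1ℚ) 1ℚ
      0≤-form (yes λ+2≤d) = 0≤-form-generic λ+2≤d
      0≤-form (no  λ+2≰d) = 0≤-form-degenerate (ℕₚ.≤-pred (ℕₚ.≰⇒> λ+2≰d))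

    clique-form-nonPos : form (ℕtoℚ (size K) - 1ℚ) 1ℚ ≤ 0ℚ
    clique-form-nonPos = 0≤q-p⇒p≤q
      (subst (λ W → 0ℚ ≤ 0ℚ - form (W - 1ℚ) 1ℚ) (sym W≡) (0≤-form (suc (suc lam) ℕₚ.≤? d)))

  clique⇒form-nonPos : ∀ {K} → IsClique adj K → 1 ℕ.≤ size K → form (ℕtoℚ (size K) - 1ℚ) 1ℚ ≤ 0ℚ
  clique⇒form-nonPos {K} clique 1≤w =
    clique-form-nonPos clique (sym (ℕₚ.suc-pred (size K) {{ℕ.>-nonZero 1≤w}}))

  private
    singleton-independent : IsIndependent adj (singleton vertex)
    singleton-independent u v u∈ v∈ =
      subst₂ (λ x y → adj x y ≡ false) (≟-sound {u = vertex} u∈) (≟-sound {u = vertex} v∈) (irreflexive vertex)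

    singleton-clique : IsClique adj (singleton vertex)
    singleton-clique u v u≢v u∈ v∈ = ⊥-elim (u≢v (trans (sym (≟-sound {u = vertex} u∈)) (≟-sound {u = vertex} v∈)))

    1≤size-singleton : 1 ℕ.≤ size (singleton vertex)
    1≤size-singleton = ℕₚ.≤-reflexive (sym (size-singleton vertex))

  -- Stand-ins for α(G) and ω(G) that are computable by a bounded search: the largest
  -- admissible size below n. They bound all independent sets, resp. cliques.
  independence-bound : ∃[ α ] (1 ℕ.≤ α × α ℕ.≤ n × 0ℚ ≤ form (nℚ - ℕtoℚ α) (ℕtoℚ α) ×
                                 (∀ S → IsIndependent adj S → size S ℕ.≤ α))
  independence-bound = α , 1≤α , α≤n , formα , bound
    where
    Admissible : ℕ → Set
    Admissible a = 0ℚ ≤ form (nℚ - ℕtoℚ a) (ℕtoℚ a)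
    admissible? : ∀ a → Dec (Admissible a)
    admissible? a = 0ℚ ℚₚ.≤? form (nℚ - ℕtoℚ a) (ℕtoℚ a)
    search : ∃[ m ] (Admissible m × m ℕ.≤ n × ∀ a → a ℕ.≤ n → Admissible a → a ℕ.≤ m)
    search = greatest admissible? n (size≤n (singleton vertex))
               (independent⇒form-nonNeg singleton-independent 1≤size-singleton)
    α : ℕ
    α = proj₁ search
    formα : Admissible α
    formα = proj₁ (proj₂ search)
    α≤n : α ℕ.≤ n
    α≤n = proj₁ (proj₂ (proj₂ search))
    bound : ∀ S → IsIndependent adj S → size S ℕ.≤ α
    bound S independent = ≤-if-positive λ 1≤a →
      proj₂ (proj₂ (proj₂ search)) (size S) (size≤n S) (independent⇒form-nonNeg independent 1≤a)
    1≤α : 1 ℕ.≤ α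
    1≤α = subst (ℕ._≤ α) (size-singleton vertex) (bound (singleton vertex) singleton-independent)

  clique-bound : ∃[ ω ] (1 ℕ.≤ ω × form (ℕtoℚ ω - 1ℚ) 1ℚ ≤ 0ℚ × (∀ K → IsClique adj K → size K ℕ.≤ ω))
  clique-bound = ω , 1≤ω , formω , bound
    where
    Admissible : ℕ → Set
    Admissible w = form (ℕtoℚ w - 1ℚ) 1ℚ ≤ 0ℚ
    admissible? : ∀ w → Dec (Admissible w)
    admissible? w = form (ℕtoℚ w - 1ℚ) 1ℚ ℚₚ.≤? 0ℚ
    search : ∃[ m ] (Admissible m × m ℕ.≤ n × ∀ w → w ℕ.≤ n → Admissible w → w ℕ.≤ m)
    search = greatest admissible? n (size≤n (singleton vertex))
               (clique⇒form-nonPos singleton-clique 1≤size-singleton)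
    ω : ℕ
    ω = proj₁ search
    formω : Admissible ω
    formω = proj₁ (proj₂ search)
    bound : ∀ K → IsClique adj K → size K ℕ.≤ ω
    bound K clique = ≤-if-positive λ 1≤w →
      proj₂ (proj₂ (proj₂ search)) (size K) (size≤n K) (clique⇒form-nonPos clique 1≤w)
    1≤ω : 1 ℕ.≤ ω
    1≤ω = subst (ℕ._≤ ω) (size-singleton vertex) (bound (singleton vertex) singleton-clique)

  c : ℚ
  c = muℚ - lamℚ

  -- X = NX / MX = n (t + μ − λ) / (2d + t + μ − λ) and Y = NY / MY = 2d / (t + μ − λ), where t = √D.
  NX MX NY MY : Surd
  NX = nℚ ⊛ (√D ⊕ ↑ c)
  MX = ↑ (ℕtoℚ (2 ℕ.* d)) ⊕ √D ⊕ ↑ c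
  NY = ↑ (ℕtoℚ (2 ℕ.* d))
  MY = √D ⊕ ↑ c

  private
    2d≡ : ℕtoℚ 2 * dℚ ≡ ℕtoℚ (2 ℕ.* d)
    2d≡ = sym (ℕtoℚ-* 2 d)

    0<n : 0ℚ < nℚ
    0<n = ℕtoℚ-pos (fin⇒1≤ vertex)

  ≤X : ∀ {a k} → 0ℚ ≤ form (nℚ - ℕtoℚ a) (ℕtoℚ a) → a ℕ.≤ n → 1 ℕ.≤ k → k ℕ.≤ a →
       ℕtoℚ k ≤[ D ] NX ∕ MX
  ≤X {a} {k} formₐ a≤n 1≤k k≤a = NonNeg-resp
    (trans (rational-part nℚ K c (ℕtoℚ 2 * dℚ)) (cong (λ T → nℚ * (0ℚ + c) - K * ((T + 0ℚ) + c)) 2d≡)) (root-part nℚ K)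
    (AboveRoot-of (ℕtoℚ-pos 1≤k) (ℕtoℚ-pos (ℕₚ.≤-trans 1≤k k≤a)) (p≤q⇒0≤q-p (ℕtoℚ-mono-≤ a≤n)) formₐ
                  (0≤q-p⇒p≤q (subst (0ℚ ≤_) (sym (cross nℚ K A))
                    (*-nonNeg (ℕtoℚ-nonNeg n) (p≤q⇒0≤q-p (ℕtoℚ-mono-≤ k≤a))))))
    where
    K A : ℚ
    K = ℕtoℚ k
    A = ℕtoℚ a
    cross : ∀ N K A → (N - K) * A - (N - A) * K ≡ N * (A - K)
    cross = solve-∀ ℚ-ring
    rational-part : ∀ N K c T → (N - K) * c - T * K ≡ N * (0ℚ + c) - K * ((T + 0ℚ) + c)
    rational-part = solve-∀ ℚ-ring
    root-part : ∀ N K → N - K ≡ N * (1ℚ + 0ℚ) - K * ((0ℚ + 1ℚ) + 0ℚ)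
    root-part = solve-∀ ℚ-ring

  Y≤ : ∀ {a W} → 0ℚ ≤ form (nℚ - ℕtoℚ a) (ℕtoℚ a) → 1 ℕ.≤ a → a ℕ.≤ n → nℚ ≤ ℕtoℚ a * (W + 1ℚ) →
       NY ∕ MY ≤[ D ] W
  Y≤ {a} {W} formₐ 1≤a a≤n n≤ = NonNeg-resp
    (trans (rational-part W c (ℕtoℚ 2 * dℚ)) (cong (λ T → W * (0ℚ + c) - T) 2d≡)) (root-part W)
    (AboveRoot-of (ℚₚ.positive⁻¹ 1ℚ) (ℕtoℚ-pos 1≤a) (p≤q⇒0≤q-p (ℕtoℚ-mono-≤ a≤n)) formₐ
                  (0≤q-p⇒p≤q (subst (0ℚ ≤_) (sym (cross nℚ (ℕtoℚ a) W)) (p≤q⇒0≤q-p n≤))))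
    where
    cross : ∀ N A W → W * A - (N - A) * 1ℚ ≡ A * (W + 1ℚ) - N
    cross = solve-∀ ℚ-ring
    rational-part : ∀ W c T → W * c - T * 1ℚ ≡ W * (0ℚ + c) - T
    rational-part = solve-∀ ℚ-ring
    root-part : ∀ W → W ≡ W * (1ℚ + 0ℚ) - 0ℚ
    root-part = solve-∀ ℚ-ring

  ≤Y : ∀ {w k} → form (ℕtoℚ w - 1ℚ) 1ℚ ≤ 0ℚ → suc k ℕ.≤ w → ℕtoℚ k ≤[ D ] NY ∕ MY
  ≤Y {w} {k} form≤0 k<w = NonNeg-resp
    (trans (rational-part (ℕtoℚ k) c (ℕtoℚ 2 * dℚ)) (cong (λ T → T - ℕtoℚ k * (0ℚ + c)) 2d≡)) (root-part (ℕtoℚ k))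
    (BelowRoot-of (ℚₚ.positive⁻¹ 1ℚ) (ℚₚ.positive⁻¹ 1ℚ) form≤0
                  (0≤q-p⇒p≤q (subst (0ℚ ≤_) (sym (cross (ℕtoℚ w) (ℕtoℚ k)))
                    (p≤q⇒0≤q-p (subst (_≤ ℕtoℚ w) (ℕtoℚ-+ 1 k) (ℕtoℚ-mono-≤ k<w))))))
    where
    cross : ∀ W K → (W - 1ℚ) * 1ℚ - K * 1ℚ ≡ W - (1ℚ + K)
    cross = solve-∀ ℚ-ring
    rational-part : ∀ K c T → T * 1ℚ - K * c ≡ T - K * (0ℚ + c)
    rational-part = solve-∀ ℚ-ring
    root-part : ∀ K → - K ≡ 0ℚ - K * (1ℚ + 0ℚ)
    root-part = solve-∀ ℚ-ring

  X≤ : ∀ {w W} → form (ℕtoℚ w - 1ℚ) 1ℚ ≤ 0ℚ → 1 ℕ.≤ w → nℚ ≤ ℕtoℚ w * W → NX ∕ MX ≤[ D ] W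
  X≤ {w} {W} form≤0 1≤w n≤ = NonNeg-resp
    (trans (rational-part nℚ W c (ℕtoℚ 2 * dℚ)) (cong (λ T → W * ((T + 0ℚ) + c) - nℚ * (0ℚ + c)) 2d≡)) (root-part nℚ W)
    (BelowRoot-of 0<W (ℚₚ.positive⁻¹ 1ℚ) form≤0
                  (0≤q-p⇒p≤q (subst (0ℚ ≤_) (sym (cross nℚ (ℕtoℚ w) W)) (p≤q⇒0≤q-p n≤))))
    where
    0<W : 0ℚ < W
    0<W = *-cancelˡ-pos (ℕtoℚ-nonNeg w) (ℚₚ.<-≤-trans 0<n n≤)
    cross : ∀ N Ω W → (Ω - 1ℚ) * W - (N - W) * 1ℚ ≡ Ω * W - N
    cross = solve-∀ ℚ-ring
    rational-part : ∀ N W c T → T * W - (N - W) * c ≡ W * ((T + 0ℚ) + c) - N * (0ℚ + c)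
    rational-part = solve-∀ ℚ-ring
    root-part : ∀ N W → - (N - W) ≡ W * ((0ℚ + 1ℚ) + 0ℚ) - N * (1ℚ + 0ℚ)
    root-part = solve-∀ ℚ-ring

  α≤⌊X⌋ : (S : VSet n) → IsIndependent adj S → (m : ℕ) → IsFloor D m NX MX → size S ℕ.≤ m
  α≤⌊X⌋ S independent m (_ , ¬1+m≤X) = ℕₚ.≮⇒≥ λ m<a →
    ¬1+m≤X (≤X (independent⇒form-nonNeg independent (ℕₚ.≤-trans (s≤s z≤n) m<a)) (size≤n S) (s≤s z≤n) m<a)

  ω≤1+⌊Y⌋ : (K : VSet n) → IsClique adj K → (m : ℕ) → IsFloor D m NY MY → size K ℕ.≤ suc m
  ω≤1+⌊Y⌋ K clique m (_ , ¬1+m≤Y) = ℕₚ.≮⇒≥ λ 1+m<w →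
    ¬1+m≤Y (≤Y (clique⇒form-nonPos clique (ℕₚ.≤-trans (s≤s z≤n) 1+m<w)) 1+m<w)

  χ≥1+⌈Y⌉ : (k : ℕ) (col : Fin n → Fin k) → IsProperColouring adj k col →
            (m : ℕ) → IsCeil D m NY MY → suc m ℕ.≤ k
  χ≥1+⌈Y⌉ k col proper zero    _          = fin⇒1≤ (col vertex)
  χ≥1+⌈Y⌉ k col proper (suc m) (_ , ¬Y≤m) = ℕₚ.≮⇒≥ λ k<2+m →
    ¬Y≤m (Y≤ {W = ℕtoℚ m} (independent⇒form-nonNeg independent 1≤a) 1≤a (size≤n I) (n≤ (ℕₚ.≤-pred k<2+m)))
    where
    class : ∃[ j ] (n ℕ.≤ k ℕ.* size (colourClass col j))
    class = large-colourClass col vertex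
    I : VSet n
    I = colourClass col (proj₁ class)
    independent : IsIndependent adj I
    independent = colourClass-independent proper (proj₁ class)
    n≤k*a : n ℕ.≤ k ℕ.* size I
    n≤k*a = proj₂ class
    1≤a : 1 ℕ.≤ size I
    1≤a = nonempty-class {k = k} (fin⇒1≤ vertex) n≤k*a
    n≤ : k ℕ.≤ suc m → nℚ ≤ ℕtoℚ (size I) * (ℕtoℚ m + 1ℚ)
    n≤ k≤1+m = subst (nℚ ≤_)
      (trans (ℕtoℚ-* (size I) (suc m)) (cong (ℕtoℚ (size I) *_) (trans (cong ℕtoℚ (ℕₚ.+-comm 1 m)) (ℕtoℚ-+ m 1))))
      (ℕtoℚ-mono-≤ (ℕₚ.≤-trans n≤k*a (ℕₚ.≤-trans (ℕₚ.*-monoˡ-≤ (size I) k≤1+m)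
                                                  (ℕₚ.≤-reflexive (ℕₚ.*-comm (suc m) (size I))))))

  χ̄≥⌈X⌉ : (k : ℕ) (col : Fin n → Fin k) → IsProperColouring (compl adj) k col →
          (m : ℕ) → IsCeil D m NX MX → m ℕ.≤ k
  χ̄≥⌈X⌉ k col proper zero    _          = z≤n
  χ̄≥⌈X⌉ k col proper (suc m) (_ , ¬X≤m) = ℕₚ.≮⇒≥ λ k<1+m →
    ¬X≤m (X≤ {W = ℕtoℚ m} (clique⇒form-nonPos clique 1≤w) 1≤w (n≤ (ℕₚ.≤-pred k<1+m)))
    where
    class : ∃[ j ] (n ℕ.≤ k ℕ.* size (colourClass col j))
    class = large-colourClass col vertex
    K : VSet n
    K = colourClass col (proj₁ class)
    clique : IsClique adj K
    clique = compl-independent⇒clique (colourClass-independent proper (proj₁ class))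
    n≤k*w : n ℕ.≤ k ℕ.* size K
    n≤k*w = proj₂ class
    1≤w : 1 ℕ.≤ size K
    1≤w = nonempty-class {k = k} (fin⇒1≤ vertex) n≤k*w
    n≤ : k ℕ.≤ m → nℚ ≤ ℕtoℚ (size K) * ℕtoℚ m
    n≤ k≤m = subst (nℚ ≤_) (ℕtoℚ-* (size K) m)
      (ℕtoℚ-mono-≤ (ℕₚ.≤-trans n≤k*w (ℕₚ.≤-trans (ℕₚ.*-monoˡ-≤ (size K) k≤m)
                                                  (ℕₚ.≤-reflexive (ℕₚ.*-comm m (size K))))))

  private
    α = proj₁ independence-bound
    1≤α = proj₁ (proj₂ independence-bound)
    α≤n = proj₁ (proj₂ (proj₂ independence-bound))
    formα = proj₁ (proj₂ (proj₂ (proj₂ independence-bound)))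
    independent≤α = proj₂ (proj₂ (proj₂ (proj₂ independence-bound)))

    ω = proj₁ clique-bound
    1≤ω = proj₁ (proj₂ clique-bound)
    formω = proj₁ (proj₂ (proj₂ clique-bound))
    compl-independent≤ω : ∀ I → IsIndependent (compl adj) I → size I ℕ.≤ ω
    compl-independent≤ω I independent = proj₂ (proj₂ (proj₂ clique-bound)) I (compl-independent⇒clique independent)

    Y≤W-1 : ∀ {W} → nℚ ≤ ℕtoℚ α * W → NY ∕ MY ≤[ D ] (W - 1ℚ)
    Y≤W-1 {W} n≤ = Y≤ {W = W - 1ℚ} formα 1≤α α≤n (subst (λ x → nℚ ≤ ℕtoℚ α * x) (sym (sub-add-cancel 1ℚ W)) n≤)

  αf≥X : ∃[ x ] (IsFracClique (compl adj) x × NX ∕ MX ≤[ D ] sumℚ x)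
  αf≥X = let x , fracClique , n≤ = uniform-fracClique (compl adj) 1≤ω compl-independent≤ω
         in  x , fracClique , X≤ formω 1≤ω n≤

  χ̄f≥X : (f : FracColouring n) → IsFracColouring (compl adj) f → NX ∕ MX ≤[ D ] totalWeight f
  χ̄f≥X f colouring = X≤ formω 1≤ω (fracColouring-bound colouring compl-independent≤ω)

  ωf≥1+Y : ∃[ x ] (IsFracClique adj x × NY ∕ MY ≤[ D ] (sumℚ x - 1ℚ))
  ωf≥1+Y = let x , fracClique , n≤ = uniform-fracClique adj 1≤α independent≤α
           in  x , fracClique , Y≤W-1 n≤

  χf≥1+Y : (f : FracColouring n) → IsFracColouring adj f → NY ∕ MY ≤[ D ] (totalWeight f - 1ℚ)
  χf≥1+Y f colouring = Y≤W-1 (fracColouring-bound colouring independent≤α)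

mainTheorem7 :
  (n d lam mu : ℕ) (adj : Adj n) → IsSRG n d lam mu adj →
  let c : ℚ
      c = ℕtoℚ mu - ℕtoℚ lam
      -- D = (μ - λ)² + 4(d - μ), so that t = √D
      D : ℚ
      D = c * c + ℕtoℚ 4 * (ℕtoℚ d - ℕtoℚ mu)
      -- n(t + μ - λ) / (2d + t + μ - λ)
      NX : Surd
      NX = ℕtoℚ n ⊛ (√D ⊕ ↑ c)
      MX : Surd
      MX = ↑ (ℕtoℚ (2 ℕ.* d)) ⊕ √D ⊕ ↑ c
      -- 2d / (t + μ - λ)
      NY : Surd
      NY = ↑ (ℕtoℚ (2 ℕ.* d))
      MY : Surd
      MY = √D ⊕ ↑ c
  in
  -- α(G) ≤ ⌊ n(t+μ-λ) / (2d+t+μ-λ) ⌋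
  ((S : VSet n) → IsIndependent adj S →
     (m : ℕ) → IsFloor D m NX MX → size S ℕ.≤ m)
  -- α_f(G) = ω_f(Ḡ) ≥ n(t+μ-λ) / (2d+t+μ-λ)
  × (∃[ x ] (IsFracClique (compl adj) x × NX ∕ MX ≤[ D ] sumℚ x))
  -- ω(G) ≤ 1 + ⌊ 2d / (t+μ-λ) ⌋
  × ((S : VSet n) → IsClique adj S →
     (m : ℕ) → IsFloor D m NY MY → size S ℕ.≤ suc m)
  -- ω_f(G) ≥ 1 + 2d / (t+μ-λ)
  × (∃[ x ] (IsFracClique adj x × NY ∕ MY ≤[ D ] (sumℚ x - 1ℚ)))
  -- χ(G) ≥ 1 + ⌈ 2d / (t+μ-λ) ⌉
  × ((k : ℕ) (col : Fin n → Fin k) → IsProperColouring adj k col →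
     (m : ℕ) → IsCeil D m NY MY → suc m ℕ.≤ k)
  -- χ_f(G) ≥ 1 + 2d / (t+μ-λ)
  × ((f : FracColouring n) → IsFracColouring adj f →
     NY ∕ MY ≤[ D ] (totalWeight f - 1ℚ))
  -- χ(Ḡ) ≥ ⌈ n(t+μ-λ) / (2d+t+μ-λ) ⌉
  × ((k : ℕ) (col : Fin n → Fin k) → IsProperColouring (compl adj) k col →
     (m : ℕ) → IsCeil D m NX MX → m ℕ.≤ k)
  -- χ_f(Ḡ) ≥ n(t+μ-λ) / (2d+t+μ-λ)
  × ((f : FracColouring n) → IsFracColouring (compl adj) f →
     NX ∕ MX ≤[ D ] totalWeight f)
mainTheorem7 n d lam mu adj srg =
  α≤⌊X⌋ , αf≥X , ω≤1+⌊Y⌋ , ωf≥1+Y , χ≥1+⌈Y⌉ , χf≥1+Y , χ̄≥⌈X⌉ , χ̄f≥X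
  where open StronglyRegular srg
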